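{- Let $n\ge4$ and let $\mathbf{Y}_n$ be the graph on vertices $0,1,\dots,n$ with a double edge from the longer vertex $0$ to the shorter vertex $1$, simple edges $1-2,\dots,(n-3)-(n-2)$, $(n-2)-(n-1)$ and $(n-2)-n$. Then $\#\mathrm{Cl}(\mathbf{Y}_n)=n+3$. Minimal representatives can be taken as follows. With $d_0=0$: for $i=0,\dots,\lceil (n-2)/2\rceil$ if $n$ is odd, resp. $i=0,\dots,n/2-1$ if $n$ is even, the labeling with ones exactly at $1,3,\dots,2i-1$; the labeling with ones exactly at $n-1,n$; and, if $n=2k$ is even, the two labelings with ones exactly at $1,3,\dots,2k-3$ and at exactly one of $n-1,n$. With $d_0=1$ and $d_1=0$: for $i=0,\dots,\lceil n/2\rceil-1$ if $n$ is even resp. $i=0,\dots,k-1$ if $n=2k+1$, the labeling with ones (besides vertex $0$) exactly at $2,4,\dots,2i$; and, if $n=2k+1$ is odd, the two labelings with ones exactly at $0$, at $2,4,\dots,2k-2$, and at exactly one of $n-1,n$.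
   Context: Generalized Reeder's puzzle: a labeling assigns $d_j\in\mathbb{Z}/2\mathbb{Z}$ to each vertex $j$. Double edges are directed from a longer to a shorter vertex. The move $T_i$ replaces $d_i$ by $d_i+\sum_k d_k\pmod 2$, where $k$ runs over neighbors of $i$ excluding any neighbor that is the shorter endpoint of a double edge at $i$; other labels unchanged. Equivalence is generated by moves; $\mathrm{Cl}(D)$ is the set of classes; a minimal representative is a labeling in its class with the fewest $1$'s. -}

module Defs where

open import Data.Bool using (Bool; true; false; _∧_; _∨_; _xor_; if_then_else_)
open import Data.Nat using (ℕ; zero; suc; _+_; _*_; _∸_; _≡ᵇ_; _≤ᵇ_)
open import Data.Nat.DivMod using (_/_; _%_)
open import Data.Fin using (Fin; toℕ)
open import Data.Vec using (Vec; []; _∷_; lookup; tabulate; _[_]≔_)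
open import Data.List using (List; []; _∷_; map; upTo; _++_)
open import Data.Bool.ListAction using (any)
open import Relation.Binary.Construct.Closure.Equivalence using (EqClosure)

-- A diagram on m vertices (Fin m) consists of
--   simple i k : there is a simple edge between i and k (symmetric)
--   double l s : there is a double edge directed from the longer vertex l
--                to the shorter vertex s.

record Diagram (m : ℕ) : Set where
  field
    simple : Fin m → Fin m → Bool
    double : Fin m → Fin m → Bool
open Diagram public

-- A labeling: d_j ∈ ℤ/2ℤ (encoded as Bool, addition = xor) at each vertex.
Labeling : ℕ → Set
Labeling m = Vec Bool m

⊕Σ : ∀ {m} → (Fin m → Bool) → Bool
⊕Σ {zero}  f = false
⊕Σ {suc m} f = f Fin.zero xor ⊕Σ (λ i → f (Fin.suc i))
  where import Data.Fin as Fin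

-- k is counted in the move T_i: k is a neighbour of i, and k is not the
-- shorter endpoint of a double edge at i (i.e. not a double edge i → k).
counted : ∀ {m} → Diagram m → Fin m → Fin m → Bool
counted D i k = simple D i k ∨ double D k i

T : ∀ {m} → Diagram m → Fin m → Labeling m → Labeling m
T D i d = d [ i ]≔ (lookup d i xor ⊕Σ (λ k → counted D i k ∧ lookup d k))

data Move {m} (D : Diagram m) : Labeling m → Labeling m → Set where
  move : ∀ i d → Move D d (T D i d)

_∼⟨_⟩_ : ∀ {m} → Labeling m → Diagram m → Labeling m → Set
d ∼⟨ D ⟩ d' = EqClosure (Move D) d d'

weight : ∀ {m} → Labeling m → ℕ
weight []          = 0
weight (true ∷ d)  = suc (weight d)
weight (false ∷ d) = weight d

YEdge : ℕ → ℕ → ℕ → Bool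
YEdge n a b = ((1 ≤ᵇ a) ∧ (b ≡ᵇ suc a) ∧ (b ≤ᵇ (n ∸ 1)))
            ∨ ((a ≡ᵇ (n ∸ 2)) ∧ (b ≡ᵇ n))

Y : (n : ℕ) → Diagram (suc n)
Y n = record
  { simple = λ i k → YEdge n (toℕ i) (toℕ k) ∨ YEdge n (toℕ k) (toℕ i)
  ; double = λ l s → (toℕ l ≡ᵇ 0) ∧ (toℕ s ≡ᵇ 1)
  }

ones : (n : ℕ) → List ℕ → Labeling (suc n)
ones n S = tabulate (λ j → any (λ s → s ≡ᵇ toℕ j) S)

odds : ℕ → List ℕ
odds i = map (λ j → 2 * j + 1) (upTo i)

evens : ℕ → List ℕ
evens i = map (λ j → 2 * j + 2) (upTo i)

repsEven : (n k : ℕ) → List (Labeling (suc n))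
repsEven n k =
     map (λ i → ones n (odds i)) (upTo k)
  ++ (ones n ((n ∸ 1) ∷ n ∷ [])
  ∷  ones n (odds (k ∸ 1) ++ ((n ∸ 1) ∷ []))
  ∷  ones n (odds (k ∸ 1) ++ (n ∷ []))
  ∷  [])
  ++ map (λ i → ones n (0 ∷ evens i)) (upTo k)

repsOdd : (n k : ℕ) → List (Labeling (suc n))
repsOdd n k =
     map (λ i → ones n (odds i)) (upTo (suc k))              -- d₀ = 0, i = 0,…,⌈(n-2)/2⌉ = k
  ++ (ones n ((n ∸ 1) ∷ n ∷ []) ∷ [])
  ++ map (λ i → ones n (0 ∷ evens i)) (upTo k)
  ++ (ones n (0 ∷ (evens (k ∸ 1) ++ ((n ∸ 1) ∷ [])))
  ∷  ones n (0 ∷ (evens (k ∸ 1) ++ (n ∷ [])))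
  ∷  [])

reps : (n : ℕ) → List (Labeling (suc n))
reps n = if n % 2 ≡ᵇ 0 then repsEven n (n / 2) else repsOdd n (n / 2)

-- Encode a labeling d of Y_n (n = 4 + t) by its difference sequence σ_j = d_j + d_(j+1), plus d_n
-- at j = n - 2, for j < n, together with d_n. The move at 0 is trivial (its only neighbour is the
-- shorter end of the double edge), the move at p + 1 < n swaps σ_p and σ_(p+1), and the move at n
-- swaps σ_(n-2) and σ_(n-1) while adding σ_(n-2) + σ_(n-1) to d_n. So the number w of ones in σ is
-- invariant, and so is d_n when σ is constant (w = 0 or w = n). Conversely, adjacent swaps sort σ,
-- and if σ is not constant the moves at n - 1 and n flip d_n without changing σ; hence
-- (w, [w ∈ {0, n}] ∧ d_n) is a complete invariant with n + 3 values. Every 1 of d contributes at most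
-- two 1's to σ, so a class has weight at least ⌈w/2⌉ (at least 2 for the class w = 0, d_n = 1),
-- and the listed labelings attain these bounds.

module Submission where

open import Defs
open import Data.Bool using (Bool; true; false; not; _∧_; _∨_; _xor_; if_then_else_)
open import Data.Bool.Properties
  using (∧-identityʳ; ∧-zeroʳ; ∨-identityʳ; ∨-zeroʳ; ¬-not; ∨-assoc; xor-identityʳ; xor-same; xor-comm; xor-assoc)
  renaming (_≟_ to _≟ᴮ_)
open import Data.Bool.Base using () renaming (T to IsTrue)
open import Data.Bool.ListAction using (any)
open import Data.Bool.Solver using (module xor-∧-Solver)
open import Data.Empty using (⊥-elim)
open import Data.Fin using (Fin; toℕ; fromℕ<; cast) renaming (zero to fzero; suc to fsuc)
open import Data.Fin.Properties using (toℕ-fromℕ<; toℕ<n; cast-involutive)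
open import Data.List using (List; []; _∷_; length; map; _++_; upTo; applyUpTo; replicate; lookup)
import Data.List.Relation.Unary.All as All
open import Data.List.Membership.Propositional using (_∈_; _∉_)
open import Data.List.Membership.Propositional.Properties
  using (∈-map⁺; ∈-map⁻; ∈-lookup; ∈-++⁺ˡ; ∈-++⁺ʳ; ∈-++⁻; ∈-upTo⁺; ∈-upTo⁻)
open import Data.List.Relation.Unary.All using (All; []; _∷_)
import Data.List.Relation.Unary.All.Properties as AllP
open import Data.List.Relation.Unary.Any using (here; there)
import Data.List.Relation.Unary.Any as Any
open import Data.List.Relation.Unary.Any.Properties using (lookup-index)
open import Data.List.Relation.Unary.AllPairs using ([]; _∷_)
open import Data.List.Relation.Unary.Unique.Propositional using (Unique)
import Data.List.Relation.Unary.Unique.Propositional.Properties as Unique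
open import Data.List.Properties
  using (∷-injective; length-applyUpTo; length-++; length-replicate; length-map; length-upTo;
         map-++; map-∘; map-applyUpTo; map-cong-local)
open import Data.Nat
  using (ℕ; zero; suc; _+_; _*_; _∸_; _≡ᵇ_; _≤ᵇ_; _<ᵇ_; _≤_; _<_; z≤n; s≤s; ⌈_/2⌉)
open import Data.Nat.Properties
  using (_≟_; _≤?_; ≡ᵇ⇒≡; ≤ᵇ⇒≤; ≤⇒≤ᵇ; suc-injective; <⇒≢; >⇒≢; <-irrefl; 1+n≰n;
         ≤-refl; ≤-reflexive; ≤-trans; ≤-pred; n≤1+n; m≤n+m; m≤m+n; m≤n⇒m<n∨m≡n; ≤∧≢⇒<; ≰⇒>;
         m+[n∸m]≡n; +-suc; +-comm; +-assoc; +-identityʳ; +-cancelˡ-≡; +-mono-≤;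
         ⌈n/2⌉-mono; n≡⌈n+n/2⌉; module ≤-Reasoning)
open import Data.Nat.DivMod using (_%_; _/_; m/n≡1+[m∸n]/n)
open import Data.Nat.Solver using (module +-*-Solver)
open import Data.Product using (Σ; ∃; _×_; _,_; proj₁; proj₂)
open import Data.Sum using (_⊎_; inj₁; inj₂)
open import Data.Unit using (tt)
open import Data.Vec using (Vec; []; _∷_; tabulate; _[_]≔_)
import Data.Vec as Vec
open import Function using (id; _∘_)
open import Relation.Binary.PropositionalEquality
open import Relation.Nullary using (¬_; yes; no)
open import Relation.Binary.Construct.Closure.ReflexiveTransitive using (Star; ε; _◅_; _◅◅_; gmap; reverse)
open import Relation.Binary.Construct.Closure.Symmetric using (fwd; bwd)
import Relation.Binary.Construct.Closure.Equivalence as EqClosure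

≡ᵇ-refl : ∀ x → (x ≡ᵇ x) ≡ true
≡ᵇ-refl zero    = refl
≡ᵇ-refl (suc x) = ≡ᵇ-refl x

≡ᵇ-sym : ∀ x y → (x ≡ᵇ y) ≡ (y ≡ᵇ x)
≡ᵇ-sym zero    zero    = refl
≡ᵇ-sym zero    (suc y) = refl
≡ᵇ-sym (suc x) zero    = refl
≡ᵇ-sym (suc x) (suc y) = ≡ᵇ-sym x y

≡ᵇ-true⇒≡ : ∀ {x y} → (x ≡ᵇ y) ≡ true → x ≡ y
≡ᵇ-true⇒≡ {x} {y} e = ≡ᵇ⇒≡ x y (subst IsTrue (sym e) tt)

≢⇒≡ᵇ-false : ∀ {x y} → x ≢ y → (x ≡ᵇ y) ≡ false
≢⇒≡ᵇ-false {x} {y} x≢y with x ≡ᵇ y in e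
... | true  = ⊥-elim (x≢y (≡ᵇ-true⇒≡ e))
... | false = refl

≡ᵇ-false⇒≢ : ∀ {x y} → (x ≡ᵇ y) ≡ false → x ≢ y
≡ᵇ-false⇒≢ {x} e refl = subst (λ b → b ≢ false) (sym (≡ᵇ-refl x)) (λ ()) e

<⇒≡ᵇ-false : ∀ {x y} → x < y → (x ≡ᵇ y) ≡ false
<⇒≡ᵇ-false = ≢⇒≡ᵇ-false ∘ <⇒≢

>⇒≡ᵇ-false : ∀ {x y} → y < x → (x ≡ᵇ y) ≡ false
>⇒≡ᵇ-false = ≢⇒≡ᵇ-false ∘ >⇒≢

+-≰ : ∀ k {x} → ¬ (suc k + x ≤ x)
+-≰ k {x} le = 1+n≰n (≤-trans (s≤s (m≤n+m x k)) le)

+-≢ : ∀ k {x} → suc k + x ≢ x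
+-≢ k = +-≰ k ∘ ≤-reflexive

+-≡ᵇ-false : ∀ k x → (suc k + x ≡ᵇ x) ≡ false
+-≡ᵇ-false k x = ≢⇒≡ᵇ-false {suc k + x} {x} (+-≢ k)

≡ᵇ-+-false : ∀ k x → (x ≡ᵇ suc k + x) ≡ false
≡ᵇ-+-false k x = ≢⇒≡ᵇ-false {x} {suc k + x} (+-≢ k ∘ sym)

≤ᵇ-true⇒≤ : ∀ {x y} → (x ≤ᵇ y) ≡ true → x ≤ y
≤ᵇ-true⇒≤ {x} {y} e = ≤ᵇ⇒≤ x y (subst IsTrue (sym e) tt)

≤⇒≤ᵇ-true : ∀ {x y} → x ≤ y → (x ≤ᵇ y) ≡ true
≤⇒≤ᵇ-true {x} {y} x≤y with x ≤ᵇ y in e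
... | true  = refl
... | false = ⊥-elim (subst IsTrue e (≤⇒≤ᵇ x≤y))

<ᵇ-suc : ∀ j m → (j <ᵇ suc m) ≡ (j <ᵇ m) xor (j ≡ᵇ m)
<ᵇ-suc zero    zero    = refl
<ᵇ-suc zero    (suc m) = refl
<ᵇ-suc (suc j) zero    = refl
<ᵇ-suc (suc j) (suc m) = <ᵇ-suc j m

∧-true⇒ : ∀ {x y} → (x ∧ y) ≡ true → x ≡ true × y ≡ true
∧-true⇒ {true} {true} _ = refl , refl

∨-true⇒ : ∀ {x y} → (x ∨ y) ≡ true → x ≡ true ⊎ y ≡ true
∨-true⇒ {true}  _ = inj₁ refl
∨-true⇒ {false} e = inj₂ e

xor-true⇒ : ∀ {x y} → (x xor y) ≡ true → x ≡ true ⊎ y ≡ true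
xor-true⇒ {true}  _ = inj₁ refl
xor-true⇒ {false} e = inj₂ e

≢true⇒≡false : ∀ {x} → x ≢ true → x ≡ false
≢true⇒≡false {true}  x≢true = ⊥-elim (x≢true refl)
≢true⇒≡false {false} _      = refl

∨-as-xor : ∀ x y → (y ≡ true → x ≡ false) → (x ∨ y) ≡ (x xor y)
∨-as-xor x     true  disjoint rewrite disjoint refl = refl
∨-as-xor true  false _        = refl
∨-as-xor false false _        = refl

xor-cancelʳ : ∀ a b c → a xor c ≡ b xor c → a ≡ b
xor-cancelʳ true  true  c e = refl
xor-cancelʳ false false c e = refl
xor-cancelʳ true  false true  ()
xor-cancelʳ true  false false ()
xor-cancelʳ false true  true  ()
xor-cancelʳ false true  false ()

-- Labelings as sequences, and the effect of a move

at : ∀ {m} → Vec Bool m → ℕ → Bool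
at []      _       = false
at (x ∷ v) zero    = x
at (x ∷ v) (suc j) = at v j

at-lookup : ∀ {m} (v : Vec Bool m) k → Vec.lookup v k ≡ at v (toℕ k)
at-lookup (x ∷ v) fzero    = refl
at-lookup (x ∷ v) (fsuc k) = at-lookup v k

at-≔-same : ∀ {m} (v : Vec Bool m) k b → at (v [ k ]≔ b) (toℕ k) ≡ b
at-≔-same (x ∷ v) fzero    b = refl
at-≔-same (x ∷ v) (fsuc k) b = at-≔-same v k b

at-≔-other : ∀ {m} (v : Vec Bool m) k b j → j ≢ toℕ k → at (v [ k ]≔ b) j ≡ at v j
at-≔-other (x ∷ v) fzero    b zero    j≢k = ⊥-elim (j≢k refl)
at-≔-other (x ∷ v) fzero    b (suc j) j≢k = refl
at-≔-other (x ∷ v) (fsuc k) b zero    j≢k = refl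
at-≔-other (x ∷ v) (fsuc k) b (suc j) j≢k = at-≔-other v k b j (j≢k ∘ cong suc)

at-injective : ∀ {m} (u v : Vec Bool m) → (∀ j → at u j ≡ at v j) → u ≡ v
at-injective []      []      _ = refl
at-injective (x ∷ u) (y ∷ v) h = cong₂ _∷_ (h 0) (at-injective u v (h ∘ suc))

at-tabulate : ∀ {m} (F : ℕ → Bool) j → j < m → at (tabulate {n = m} (F ∘ toℕ)) j ≡ F j
at-tabulate {suc m} F zero    _         = refl
at-tabulate {suc m} F (suc j) (s≤s j<m) = at-tabulate (F ∘ suc) j j<m

at-beyond : ∀ {m} (v : Vec Bool m) j → m ≤ j → at v j ≡ false
at-beyond []      j       _         = refl
at-beyond (x ∷ v) (suc j) (s≤s m≤j) = at-beyond v j m≤j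

xorSum : ℕ → (ℕ → Bool) → Bool
xorSum zero    F = false
xorSum (suc N) F = F 0 xor xorSum N (F ∘ suc)

⊕Σ≡xorSum : ∀ {N} (f : Fin N → Bool) (F : ℕ → Bool) → (∀ k → f k ≡ F (toℕ k)) → ⊕Σ f ≡ xorSum N F
⊕Σ≡xorSum {zero}  f F h = refl
⊕Σ≡xorSum {suc N} f F h = cong₂ _xor_ (h fzero) (⊕Σ≡xorSum (f ∘ fsuc) (F ∘ suc) (h ∘ fsuc))

xorSum-cong : ∀ N {F G : ℕ → Bool} → (∀ j → F j ≡ G j) → xorSum N F ≡ xorSum N G
xorSum-cong zero    h = refl
xorSum-cong (suc N) h = cong₂ _xor_ (h 0) (xorSum-cong N (h ∘ suc))

xorSum-false : ∀ N → xorSum N (λ _ → false) ≡ false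
xorSum-false zero    = refl
xorSum-false (suc N) = xorSum-false N

xorSum-xor : ∀ N (F G : ℕ → Bool) → xorSum N (λ j → F j xor G j) ≡ xorSum N F xor xorSum N G
xorSum-xor zero    F G = refl
xorSum-xor (suc N) F G =
  trans (cong ((F 0 xor G 0) xor_) (xorSum-xor N (F ∘ suc) (G ∘ suc))) (interchange (F 0) (G 0) _ _)
  where
  open xor-∧-Solver
  interchange : ∀ a b c d → (a xor b) xor (c xor d) ≡ (a xor c) xor (b xor d)
  interchange = solve 4 (λ a b c d → (a :+ b) :+ (c :+ d) := (a :+ c) :+ (b :+ d)) refl

xorSum-point : ∀ N a (L : ℕ → Bool) → a < N → xorSum N (λ j → (j ≡ᵇ a) ∧ L j) ≡ L a
xorSum-point (suc N) zero    L _         = trans (cong (L 0 xor_) (xorSum-false N)) (xor-identityʳ _)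
xorSum-point (suc N) (suc a) L (s≤s a<N) = xorSum-point N a (L ∘ suc) a<N

at-T : ∀ {m} (D : Diagram m) (C : ℕ → ℕ → Bool) → (∀ i k → counted D i k ≡ C (toℕ i) (toℕ k)) →
  ∀ i d j → at (T D i d) j ≡ at d j xor ((j ≡ᵇ toℕ i) ∧ xorSum m (λ k → C (toℕ i) k ∧ at d k))
at-T {m} D C hC i d j with j ≡ᵇ toℕ i in e
... | true  = subst (λ x → at (T D i d) x ≡ at d x xor sum) (sym (≡ᵇ-true⇒≡ e))
                (trans (at-≔-same d i _) (cong₂ _xor_ (at-lookup d i)
                  (⊕Σ≡xorSum _ (λ k → C (toℕ i) k ∧ at d k) (λ k → cong₂ _∧_ (hC i k) (at-lookup d k)))))
  where sum = xorSum m (λ k → C (toℕ i) k ∧ at d k)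
... | false = trans (at-≔-other d i _ j (≡ᵇ-false⇒≢ e)) (sym (xor-identityʳ _))

-- Lists of bits: adjacent transpositions and counting

swapAdjacent : ∀ {A : Set} → ℕ → List A → List A
swapAdjacent zero    (x ∷ y ∷ zs) = y ∷ x ∷ zs
swapAdjacent zero    xs           = xs
swapAdjacent (suc q) []           = []
swapAdjacent (suc q) (x ∷ xs)     = x ∷ swapAdjacent q xs

length-swapAdjacent : ∀ {A : Set} q (xs : List A) → length (swapAdjacent q xs) ≡ length xs
length-swapAdjacent zero    []           = refl
length-swapAdjacent zero    (x ∷ [])     = refl
length-swapAdjacent zero    (x ∷ y ∷ zs) = refl
length-swapAdjacent (suc q) []           = refl
length-swapAdjacent (suc q) (x ∷ xs)     = cong suc (length-swapAdjacent q xs)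

swapAdjacent-involutive : ∀ {A : Set} q (xs : List A) → swapAdjacent q (swapAdjacent q xs) ≡ xs
swapAdjacent-involutive zero    []           = refl
swapAdjacent-involutive zero    (x ∷ [])     = refl
swapAdjacent-involutive zero    (x ∷ y ∷ zs) = refl
swapAdjacent-involutive (suc q) []           = refl
swapAdjacent-involutive (suc q) (x ∷ xs)     = cong (x ∷_) (swapAdjacent-involutive q xs)

applyUpTo-cong : ∀ {A : Set} N {f g : ℕ → A} → (∀ j → j < N → f j ≡ g j) → applyUpTo f N ≡ applyUpTo g N
applyUpTo-cong zero    h = refl
applyUpTo-cong (suc N) h = cong₂ _∷_ (h 0 (s≤s z≤n)) (applyUpTo-cong N (λ j j<N → h (suc j) (s≤s j<N)))

applyUpTo-injective : ∀ {A : Set} N {f g : ℕ → A} → applyUpTo f N ≡ applyUpTo g N → ∀ j → j < N → f j ≡ g j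
applyUpTo-injective (suc N) e zero    _         = proj₁ (∷-injective e)
applyUpTo-injective (suc N) e (suc j) (s≤s j<N) = applyUpTo-injective N (proj₂ (∷-injective e)) j j<N

swapAt : ℕ → (ℕ → Bool) → ℕ → Bool
swapAt q σ j = σ j xor ((σ q xor σ (suc q)) ∧ ((j ≡ᵇ q) xor (j ≡ᵇ suc q)))

swapAt-left : ∀ q σ → swapAt q σ q ≡ σ (suc q)
swapAt-left q σ rewrite ≡ᵇ-refl q | ≡ᵇ-+-false 0 q = lemma (σ q) (σ (suc q))
  where
  lemma : ∀ a b → a xor ((a xor b) ∧ true) ≡ b
  lemma true  true  = refl
  lemma true  false = refl
  lemma false true  = refl
  lemma false false = refl

swapAt-right : ∀ q σ → swapAt q σ (suc q) ≡ σ q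
swapAt-right q σ rewrite ≡ᵇ-refl q | +-≡ᵇ-false 0 q = lemma (σ q) (σ (suc q))
  where
  lemma : ∀ a b → b xor ((a xor b) ∧ true) ≡ a
  lemma true  true  = refl
  lemma true  false = refl
  lemma false true  = refl
  lemma false false = refl

swapAt-preserves-xor : ∀ q σ → swapAt q σ q xor swapAt q σ (suc q) ≡ σ q xor σ (suc q)
swapAt-preserves-xor q σ = trans (cong₂ _xor_ (swapAt-left q σ) (swapAt-right q σ)) (xor-comm (σ (suc q)) (σ q))

applyUpTo-swapAt : ∀ N q σ → suc q < N → applyUpTo (swapAt q σ) N ≡ swapAdjacent q (applyUpTo σ N)
applyUpTo-swapAt (suc (suc N)) zero σ _ =
  cong₂ _∷_ (swapAt-left 0 σ) (cong₂ _∷_ (swapAt-right 0 σ)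
    (applyUpTo-cong N (λ j _ → trans (cong (σ (2 + j) xor_) (∧-zeroʳ _)) (xor-identityʳ _))))
applyUpTo-swapAt (suc N) (suc q) σ (s≤s q<N) =
  cong₂ _∷_ (trans (cong (σ 0 xor_) (∧-zeroʳ _)) (xor-identityʳ _)) (applyUpTo-swapAt N q (σ ∘ suc) q<N)

trues : List Bool → ℕ
trues []           = 0
trues (true  ∷ xs) = suc (trues xs)
trues (false ∷ xs) = trues xs

trues-swapAdjacent : ∀ q xs → trues (swapAdjacent q xs) ≡ trues xs
trues-swapAdjacent zero    []                  = refl
trues-swapAdjacent zero    (x ∷ [])            = refl
trues-swapAdjacent zero    (true  ∷ true  ∷ _) = refl
trues-swapAdjacent zero    (true  ∷ false ∷ _) = refl
trues-swapAdjacent zero    (false ∷ true  ∷ _) = refl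
trues-swapAdjacent zero    (false ∷ false ∷ _) = refl
trues-swapAdjacent (suc q) []                  = refl
trues-swapAdjacent (suc q) (true  ∷ xs)        = cong suc (trues-swapAdjacent q xs)
trues-swapAdjacent (suc q) (false ∷ xs)        = trues-swapAdjacent q xs

trues≤length : ∀ xs → trues xs ≤ length xs
trues≤length []           = z≤n
trues≤length (true  ∷ xs) = s≤s (trues≤length xs)
trues≤length (false ∷ xs) = ≤-trans (trues≤length xs) (n≤1+n _)

trues≡0⇒false : ∀ N f → trues (applyUpTo f N) ≡ 0 → ∀ j → j < N → f j ≡ false
trues≡0⇒false (suc N) f e j j<N with f 0 in f0
trues≡0⇒false (suc N) f e zero    _         | false = f0
trues≡0⇒false (suc N) f e (suc j) (s≤s j<N) | false = trues≡0⇒false N (f ∘ suc) e j j<N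

trues≡N⇒true : ∀ N f → trues (applyUpTo f N) ≡ N → ∀ j → j < N → f j ≡ true
trues≡N⇒true (suc N) f e j j<N with f 0 in f0
trues≡N⇒true (suc N) f e zero    _         | true  = f0
trues≡N⇒true (suc N) f e (suc j) (s≤s j<N) | true  = trues≡N⇒true N (f ∘ suc) (suc-injective e) j j<N
trues≡N⇒true (suc N) f e j       _         | false = ⊥-elim (1+n≰n
  (subst (_≤ N) e (≤-trans (trues≤length (applyUpTo (f ∘ suc) N)) (≤-reflexive (length-applyUpTo (f ∘ suc) N)))))

trues-++ : ∀ xs ys → trues (xs ++ ys) ≡ trues xs + trues ys
trues-++ []           ys = refl
trues-++ (true  ∷ xs) ys = cong suc (trues-++ xs ys)
trues-++ (false ∷ xs) ys = trues-++ xs ys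

trues-replicate-true : ∀ a → trues (replicate a true) ≡ a
trues-replicate-true zero    = refl
trues-replicate-true (suc a) = cong suc (trues-replicate-true a)

trues-replicate-false : ∀ a → trues (replicate a false) ≡ 0
trues-replicate-false zero    = refl
trues-replicate-false (suc a) = trues-replicate-false a

Swap : List Bool → List Bool → Set
Swap xs ys = ∃ λ q → suc q < length xs × ys ≡ swapAdjacent q xs

Swap-sym : ∀ {xs ys} → Swap xs ys → Swap ys xs
Swap-sym {xs} (q , q< , refl) =
  q , subst (suc q <_) (sym (length-swapAdjacent q xs)) q< , sym (swapAdjacent-involutive q xs)

Swap-∷ : ∀ x {xs ys} → Swap xs ys → Swap (x ∷ xs) (x ∷ ys)
Swap-∷ x (q , q< , refl) = suc q , s≤s q< , refl

falses : List Bool → ℕ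
falses []           = 0
falses (true  ∷ xs) = falses xs
falses (false ∷ xs) = suc (falses xs)

length≡trues+falses : ∀ xs → length xs ≡ trues xs + falses xs
length≡trues+falses []           = refl
length≡trues+falses (true  ∷ xs) = cong suc (length≡trues+falses xs)
length≡trues+falses (false ∷ xs) = trans (cong suc (length≡trues+falses xs)) (sym (+-suc (trues xs) (falses xs)))

sorted : List Bool → List Bool
sorted xs = replicate (trues xs) true ++ replicate (falses xs) false

bubble : ∀ c ys → Star Swap (false ∷ replicate c true ++ ys) (replicate c true ++ false ∷ ys)
bubble zero    ys = ε
bubble (suc c) ys = (0 , s≤s (s≤s z≤n) , refl) ◅ gmap (true ∷_) (Swap-∷ true) (bubble c ys)

sort-by-swaps : ∀ xs → Star Swap xs (sorted xs)
sort-by-swaps []           = ε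
sort-by-swaps (true  ∷ xs) = gmap (true ∷_) (Swap-∷ true) (sort-by-swaps xs)
sort-by-swaps (false ∷ xs) =
  gmap (false ∷_) (Swap-∷ false) (sort-by-swaps xs) ◅◅ bubble (trues xs) (replicate (falses xs) false)

sorted-≡ : ∀ xs ys → length xs ≡ length ys → trues xs ≡ trues ys → sorted xs ≡ sorted ys
sorted-≡ xs ys len≡ trues≡ = cong₂ (λ a b → replicate a true ++ replicate b false) trues≡
  (+-cancelˡ-≡ (trues xs) _ _ (begin
    trues xs + falses xs ≡⟨ sym (length≡trues+falses xs) ⟩
    length xs            ≡⟨ len≡ ⟩
    length ys            ≡⟨ length≡trues+falses ys ⟩
    trues ys + falses ys ≡⟨ cong (_+ falses ys) (sym trues≡) ⟩
    trues xs + falses ys ∎))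
  where open ≡-Reasoning

swaps-connect : ∀ xs ys → length xs ≡ length ys → trues xs ≡ trues ys → Star Swap xs ys
swaps-connect xs ys len≡ trues≡ =
  sort-by-swaps xs ◅◅ subst (λ zs → Star Swap zs ys) (sym (sorted-≡ xs ys len≡ trues≡))
                             (reverse Swap-sym (sort-by-swaps ys))

nth : List Bool → ℕ → Bool
nth []       _       = false
nth (x ∷ xs) zero    = x
nth (x ∷ xs) (suc j) = nth xs j

nth-applyUpTo : ∀ N f j → j < N → nth (applyUpTo f N) j ≡ f j
nth-applyUpTo (suc N) f zero    _         = refl
nth-applyUpTo (suc N) f (suc j) (s≤s j<N) = nth-applyUpTo N (f ∘ suc) j j<N

nth-++ : ∀ xs ys k → nth (xs ++ ys) (length xs + k) ≡ nth ys k
nth-++ []       ys k = refl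
nth-++ (x ∷ xs) ys k = nth-++ xs ys k

bit : Bool → ℕ
bit true  = 1
bit false = 0

count : ℕ → (ℕ → Bool) → ℕ
count N f = trues (applyUpTo f N)

count-cong : ∀ N {f g} → (∀ j → f j ≡ g j) → count N f ≡ count N g
count-cong N h = cong trues (applyUpTo-cong N (λ j _ → h j))

count-suc : ∀ N f → count (suc N) f ≡ bit (f 0) + count N (f ∘ suc)
count-suc N f with f 0
... | true  = refl
... | false = refl

count-sucʳ : ∀ N f → count (suc N) f ≡ count N f + bit (f N)
count-sucʳ zero    f = trans (count-suc 0 f) (+-comm (bit (f 0)) 0)
count-sucʳ (suc N) f = begin
  count (2 + N) f                          ≡⟨ count-suc (suc N) f ⟩
  bit (f 0) + count (suc N) (f ∘ suc)      ≡⟨ cong (bit (f 0) +_) (count-sucʳ N (f ∘ suc)) ⟩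
  bit (f 0) + (count N (f ∘ suc) + bit (f (suc N))) ≡⟨ sym (+-assoc (bit (f 0)) _ _) ⟩
  (bit (f 0) + count N (f ∘ suc)) + bit (f (suc N)) ≡⟨ cong (_+ bit (f (suc N))) (sym (count-suc N f)) ⟩
  count (suc N) f + bit (f (suc N))        ∎
  where open ≡-Reasoning

count-false : ∀ N → count N (λ _ → false) ≡ 0
count-false zero    = refl
count-false (suc N) = count-false N

count-subadditive : ∀ N (f g h : ℕ → Bool) → (∀ j → f j ≡ true → g j ≡ true ⊎ h j ≡ true) →
  count N f ≤ count N g + count N h
count-subadditive zero    f g h cover = z≤n
count-subadditive (suc N) f g h cover = begin
  count (suc N) f                                                  ≡⟨ count-suc N f ⟩
  bit (f 0) + count N (f ∘ suc)
    ≤⟨ +-mono-≤ (bit-subadditive (f 0) (g 0) (h 0) (cover 0))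
                (count-subadditive N (f ∘ suc) (g ∘ suc) (h ∘ suc) (cover ∘ suc)) ⟩
  (bit (g 0) + bit (h 0)) + (count N (g ∘ suc) + count N (h ∘ suc)) ≡⟨ interchange (bit (g 0)) (bit (h 0)) _ _ ⟩
  (bit (g 0) + count N (g ∘ suc)) + (bit (h 0) + count N (h ∘ suc)) ≡⟨ sym (cong₂ _+_ (count-suc N g) (count-suc N h)) ⟩
  count (suc N) g + count (suc N) h                                ∎
  where
  open ≤-Reasoning
  bit-subadditive : ∀ a b c → (a ≡ true → b ≡ true ⊎ c ≡ true) → bit a ≤ bit b + bit c
  bit-subadditive false b     c     _     = z≤n
  bit-subadditive true  true  c     _     = s≤s z≤n
  bit-subadditive true  false true  _     = s≤s z≤n
  bit-subadditive true  false false cover with cover refl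
  ... | inj₁ ()
  ... | inj₂ ()
  interchange : ∀ a b c d → (a + b) + (c + d) ≡ (a + c) + (b + d)
  interchange = +-*-Solver.solve 4 (λ a b c d → (a :+ b) :+ (c :+ d) := (a :+ c) :+ (b :+ d)) refl
    where open +-*-Solver

count-single : ∀ N a → count N (a ≡ᵇ_) ≤ 1
count-single zero    a       = z≤n
count-single (suc N) zero    = s≤s (≤-reflexive (count-false N))
count-single (suc N) (suc a) = count-single N a

count-point : ∀ N a b → count N (λ j → (j ≡ᵇ a) ∧ b) ≤ bit b
count-point N a true  =
  ≤-trans (≤-reflexive (count-cong N (λ j → trans (∧-identityʳ _) (≡ᵇ-sym j a)))) (count-single N a)
count-point N a false = ≤-reflexive (trans (count-cong N (λ j → ∧-zeroʳ (j ≡ᵇ a))) (count-false N))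

count-two-last : ∀ N f → f N ≡ true → f (suc N) ≡ true → 2 ≤ count (2 + N) f
count-two-last N f fN fN+1 = begin
  2                                         ≤⟨ m≤n+m 2 (count N f) ⟩
  count N f + 2                             ≡⟨ sym (+-assoc (count N f) 1 1) ⟩
  (count N f + 1) + 1                       ≡⟨ cong₂ (λ a b → (count N f + bit a) + bit b) (sym fN) (sym fN+1) ⟩
  (count N f + bit (f N)) + bit (f (suc N)) ≡⟨ cong (_+ bit (f (suc N))) (sym (count-sucʳ N f)) ⟩
  count (suc N) f + bit (f (suc N))         ≡⟨ sym (count-sucʳ (suc N) f) ⟩
  count (2 + N) f                           ∎
  where open ≤-Reasoning

count-<ᵇ : ∀ N w → w ≤ N → count N (_<ᵇ w) ≡ w
count-<ᵇ N       zero    _         = count-false N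
count-<ᵇ (suc N) (suc w) (s≤s w≤N) = cong suc (count-<ᵇ N w w≤N)

weight≡count : ∀ {m} (v : Vec Bool m) → weight v ≡ count m (at v)
weight≡count []          = refl
weight≡count (true ∷ v)  = cong suc (weight≡count v)
weight≡count (false ∷ v) = weight≡count v

twice : ℕ → ℕ
twice zero    = zero
twice (suc i) = suc (suc (twice i))

twice≡+ : ∀ u → twice u ≡ u + u
twice≡+ zero    = refl
twice≡+ (suc u) = cong suc (trans (cong suc (twice≡+ u)) (sym (+-suc u u)))

twice-injective : ∀ {i j} → twice i ≡ twice j → i ≡ j
twice-injective {zero}  {zero}  _ = refl
twice-injective {suc i} {suc j} e = cong suc (twice-injective (suc-injective (suc-injective e)))

twice≢suc-twice : ∀ i j → twice i ≢ suc (twice j)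
twice≢suc-twice (suc i) (suc j) e = twice≢suc-twice i j (suc-injective (suc-injective e))

twice-mono : ∀ {i j} → i ≤ j → twice i ≤ twice j
twice-mono z≤n       = z≤n
twice-mono (s≤s i≤j) = s≤s (s≤s (twice-mono i≤j))

twice-cancel-≤ : ∀ i j → twice i ≤ suc (twice j) → i ≤ j
twice-cancel-≤ zero    j       _                 = z≤n
twice-cancel-≤ (suc i) (suc j) (s≤s (s≤s i≤j)) = s≤s (twice-cancel-≤ i j i≤j)

⌈twice/2⌉ : ∀ i → ⌈ twice i /2⌉ ≡ i
⌈twice/2⌉ zero    = refl
⌈twice/2⌉ (suc i) = cong suc (⌈twice/2⌉ i)

⌈suc-twice/2⌉ : ∀ i → ⌈ suc (twice i) /2⌉ ≡ suc i
⌈suc-twice/2⌉ zero    = refl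
⌈suc-twice/2⌉ (suc i) = cong suc (⌈suc-twice/2⌉ i)

twice-%2 : ∀ i → twice i % 2 ≡ 0
twice-%2 zero    = refl
twice-%2 (suc i) = twice-%2 i

suc-twice-%2 : ∀ i → suc (twice i) % 2 ≡ 1
suc-twice-%2 zero    = refl
suc-twice-%2 (suc i) = suc-twice-%2 i

twice-/2 : ∀ i → twice i / 2 ≡ i
twice-/2 zero    = refl
twice-/2 (suc i) = trans (m/n≡1+[m∸n]/n {twice (suc i)} {2} (s≤s (s≤s z≤n))) (cong suc (twice-/2 i))

suc-twice-/2 : ∀ i → suc (twice i) / 2 ≡ i
suc-twice-/2 zero    = refl
suc-twice-/2 (suc i) = trans (m/n≡1+[m∸n]/n {suc (twice (suc i))} {2} (s≤s (s≤s z≤n))) (cong suc (suc-twice-/2 i))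

data Parity : ℕ → Set where
  even : ∀ i → Parity (twice i)
  odd  : ∀ i → Parity (suc (twice i))

parity : ∀ w → Parity w
parity zero          = even 0
parity (suc zero)    = odd 0
parity (suc (suc w)) with parity w
... | even i = even (suc i)
... | odd  i = odd (suc i)

mem : List ℕ → ℕ → Bool
mem S j = any (λ s → s ≡ᵇ j) S

mem-++ : ∀ S S′ j → mem (S ++ S′) j ≡ mem S j ∨ mem S′ j
mem-++ []      S′ j = refl
mem-++ (s ∷ S) S′ j = trans (cong ((s ≡ᵇ j) ∨_) (mem-++ S S′ j)) (sym (∨-assoc (s ≡ᵇ j) (mem S j) (mem S′ j)))

mem-map-suc : ∀ S j → mem (map suc S) (suc j) ≡ mem S j
mem-map-suc []      j = refl
mem-map-suc (s ∷ S) j = cong ((s ≡ᵇ j) ∨_) (mem-map-suc S j)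

mem-map-suc-0 : ∀ S → mem (map suc S) 0 ≡ false
mem-map-suc-0 []      = refl
mem-map-suc-0 (s ∷ S) = mem-map-suc-0 S

at-ones : ∀ n S j → j < suc n → at (ones n S) j ≡ mem S j
at-ones n S = at-tabulate (mem S)

count-mem : ∀ N S → count N (mem S) ≤ length S
count-mem N []      = ≤-reflexive (count-false N)
count-mem N (s ∷ S) = begin
  count N (mem (s ∷ S))              ≤⟨ count-subadditive N (mem (s ∷ S)) (s ≡ᵇ_) (mem S) (λ _ → ∨-true⇒) ⟩
  count N (s ≡ᵇ_) + count N (mem S)  ≤⟨ +-mono-≤ (count-single N s) (count-mem N S) ⟩
  suc (length S)                     ∎
  where open ≤-Reasoning

weight-ones : ∀ n S → weight (ones n S) ≤ length S
weight-ones n S = begin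
  weight (ones n S)             ≡⟨ weight≡count (ones n S) ⟩
  count (suc n) (at (ones n S)) ≡⟨ cong trues (applyUpTo-cong (suc n) (at-ones n S)) ⟩
  count (suc n) (mem S)         ≤⟨ count-mem (suc n) S ⟩
  length S                      ∎
  where open ≤-Reasoning

oddPattern : ℕ → ℕ → Bool
oddPattern zero    _             = false
oddPattern (suc i) zero          = false
oddPattern (suc i) (suc zero)    = true
oddPattern (suc i) (suc (suc j)) = oddPattern i j

evenPattern : ℕ → ℕ → Bool
evenPattern i zero    = true
evenPattern i (suc j) = oddPattern i j

oddPattern-0 : ∀ i → oddPattern i 0 ≡ false
oddPattern-0 zero    = refl
oddPattern-0 (suc i) = refl

oddPattern-step : ∀ i j → oddPattern i j xor oddPattern i (suc j) ≡ (j <ᵇ twice i)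
oddPattern-step zero    j             = refl
oddPattern-step (suc i) zero          = refl
oddPattern-step (suc i) (suc zero)    = cong not (oddPattern-0 i)
oddPattern-step (suc i) (suc (suc j)) = oddPattern-step i j

evenPattern-step : ∀ i j → evenPattern i j xor evenPattern i (suc j) ≡ (j <ᵇ suc (twice i))
evenPattern-step i zero    = cong not (oddPattern-0 i)
evenPattern-step i (suc j) = oddPattern-step i j

oddPattern-beyond : ∀ i j → twice i ≤ j → oddPattern i j ≡ false
oddPattern-beyond zero    j             _               = refl
oddPattern-beyond (suc i) (suc (suc j)) (s≤s (s≤s i≤j)) = oddPattern-beyond i j i≤j

evenPattern-beyond : ∀ i j → suc (twice i) ≤ j → evenPattern i j ≡ false
evenPattern-beyond i (suc j) (s≤s i≤j) = oddPattern-beyond i j i≤j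

odds-suc : ∀ i → odds (suc i) ≡ 1 ∷ map suc (map suc (odds i))
odds-suc i = cong (1 ∷_) (begin
  map (λ j → 2 * j + 1) (applyUpTo suc i)  ≡⟨ map-applyUpTo suc (λ j → 2 * j + 1) i ⟩
  applyUpTo (λ j → 2 * suc j + 1) i        ≡⟨ applyUpTo-cong i (λ j _ → step j) ⟩
  applyUpTo (λ j → 2 + (2 * j + 1)) i      ≡⟨ sym (map-applyUpTo (λ j → 2 * j + 1) (2 +_) i) ⟩
  map (2 +_) (applyUpTo (λ j → 2 * j + 1) i) ≡⟨ cong (map (2 +_)) (sym (map-applyUpTo id (λ j → 2 * j + 1) i)) ⟩
  map (2 +_) (odds i)                      ≡⟨ map-∘ (odds i) ⟩
  map suc (map suc (odds i))               ∎)
  where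
  open ≡-Reasoning
  step : ∀ j → 2 * suc j + 1 ≡ 2 + (2 * j + 1)
  step = +-*-Solver.solve 1 (λ j → con 2 :* (con 1 :+ j) :+ con 1 := con 2 :+ (con 2 :* j :+ con 1)) refl
    where open +-*-Solver

evens≡map-suc-odds : ∀ i → evens i ≡ map suc (odds i)
evens≡map-suc-odds i = trans (map-cong-local (All.tabulate (λ {j} _ → +-suc (2 * j) 1))) (map-∘ (upTo i))

length-odds : ∀ i → length (odds i) ≡ i
length-odds i = trans (length-map _ (upTo i)) (length-upTo i)

length-evens : ∀ i → length (evens i) ≡ i
length-evens i = trans (length-map _ (upTo i)) (length-upTo i)

mem-odds : ∀ i j → mem (odds i) j ≡ oddPattern i j
mem-odds zero    j             = refl
mem-odds (suc i) zero          = trans (cong (λ S → mem S 0) (odds-suc i)) (mem-map-suc-0 (map suc (odds i)))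
mem-odds (suc i) (suc zero)    = cong (λ S → mem S 1) (odds-suc i)
mem-odds (suc i) (suc (suc j)) = begin
  mem (odds (suc i)) (2 + j)                    ≡⟨ cong (λ S → mem S (2 + j)) (odds-suc i) ⟩
  mem (1 ∷ map suc (map suc (odds i))) (2 + j)  ≡⟨ mem-map-suc (map suc (odds i)) (suc j) ⟩
  mem (map suc (odds i)) (suc j)                ≡⟨ mem-map-suc (odds i) j ⟩
  mem (odds i) j                                ≡⟨ mem-odds i j ⟩
  oddPattern i j                                ∎
  where open ≡-Reasoning

mem-evens : ∀ i j → mem (0 ∷ evens i) j ≡ evenPattern i j
mem-evens i zero    = refl
mem-evens i (suc j) = trans (cong (λ S → mem S (suc j)) (evens≡map-suc-odds i))
                            (trans (mem-map-suc (odds i) j) (mem-odds i j))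

-- Neighbourhoods in Y_n

PathEdge : ℕ → ℕ → ℕ → Set
PathEdge n a b = 1 ≤ a × b ≡ suc a × b ≤ n ∸ 1

ForkEdge : ℕ → ℕ → ℕ → Set
ForkEdge n a b = a ≡ n ∸ 2 × b ≡ n

Edge : ℕ → ℕ → ℕ → Set
Edge n a b = PathEdge n a b ⊎ ForkEdge n a b

ForkEdge-sound : ∀ {n a b} → ((a ≡ᵇ n ∸ 2) ∧ (b ≡ᵇ n)) ≡ true → ForkEdge n a b
ForkEdge-sound e = ≡ᵇ-true⇒≡ (proj₁ (∧-true⇒ e)) , ≡ᵇ-true⇒≡ (proj₂ (∧-true⇒ e))

YEdge-sound : ∀ {n a b} → YEdge n a b ≡ true → Edge n a b
YEdge-sound {n} {a} {b} e with 1 ≤ᵇ a in e₁ | b ≡ᵇ suc a in e₂ | b ≤ᵇ n ∸ 1 in e₃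
... | true  | true  | true  = inj₁ (≤ᵇ-true⇒≤ e₁ , ≡ᵇ-true⇒≡ e₂ , ≤ᵇ-true⇒≤ e₃)
... | true  | true  | false = inj₂ (ForkEdge-sound e)
... | true  | false | _     = inj₂ (ForkEdge-sound e)
... | false | _     | _     = inj₂ (ForkEdge-sound e)

YEdge-complete : ∀ {n a b} → Edge n a b → YEdge n a b ≡ true
YEdge-complete {n} {a} (inj₁ (1≤a , refl , b≤n-1))
  rewrite ≤⇒≤ᵇ-true 1≤a | ≡ᵇ-refl a | ≤⇒≤ᵇ-true b≤n-1 = refl
YEdge-complete {n} (inj₂ (refl , refl)) rewrite ≡ᵇ-refl (n ∸ 2) | ≡ᵇ-refl n = ∨-zeroʳ _

adjacent : ℕ → ℕ → ℕ → Bool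
adjacent n a b = (YEdge n a b ∨ YEdge n b a) ∨ ((b ≡ᵇ 0) ∧ (a ≡ᵇ 1))

Adjacent : ℕ → ℕ → ℕ → Set
Adjacent n a b = (Edge n a b ⊎ Edge n b a) ⊎ (b ≡ 0 × a ≡ 1)

adjacent-sound : ∀ {n a b} → adjacent n a b ≡ true → Adjacent n a b
adjacent-sound {n} {a} {b} e with ∨-true⇒ {YEdge n a b ∨ YEdge n b a} e
... | inj₂ e′ = inj₂ (≡ᵇ-true⇒≡ (proj₁ (∧-true⇒ e′)) , ≡ᵇ-true⇒≡ (proj₂ (∧-true⇒ e′)))
... | inj₁ e′ with ∨-true⇒ {YEdge n a b} e′
...   | inj₁ e″ = inj₁ (inj₁ (YEdge-sound e″))
...   | inj₂ e″ = inj₁ (inj₂ (YEdge-sound e″))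

adjacent-complete : ∀ n a b → Adjacent n a b → adjacent n a b ≡ true
adjacent-complete n a b (inj₁ (inj₁ e)) rewrite YEdge-complete e = refl
adjacent-complete n a b (inj₁ (inj₂ e)) rewrite YEdge-complete e | ∨-zeroʳ (YEdge n a b) = refl
adjacent-complete n a b (inj₂ (refl , refl)) = ∨-zeroʳ _

adjacent-false : ∀ n a b → ¬ Adjacent n a b → adjacent n a b ≡ false
adjacent-false _ _ _ ¬adj = ≢true⇒≡false (¬adj ∘ adjacent-sound)

adjacent-first : ∀ t j → adjacent (4 + t) 0 j ≡ false
adjacent-first t j = adjacent-false (4 + t) 0 j λ
  { (inj₁ (inj₁ (inj₁ (() , _))))
  ; (inj₁ (inj₁ (inj₂ (() , _))))
  ; (inj₁ (inj₂ (inj₁ (_ , () , _))))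
  ; (inj₁ (inj₂ (inj₂ (_ , ()))))
  ; (inj₂ (_ , ())) }

adjacent-last : ∀ t j → adjacent (4 + t) (4 + t) j ≡ (j ≡ᵇ 2 + t)
adjacent-last t j with j ≟ 2 + t
... | yes refl = trans (adjacent-complete (4 + t) (4 + t) (2 + t) (inj₁ (inj₂ (inj₂ (refl , refl))))) (sym (≡ᵇ-refl (2 + t)))
... | no j≢n-2 = trans (adjacent-false (4 + t) (4 + t) j λ
  { (inj₁ (inj₁ (inj₁ (_ , refl , le)))) → +-≰ 1 le
  ; (inj₁ (inj₁ (inj₂ (e , _))))         → +-≢ 1 e
  ; (inj₁ (inj₂ (inj₁ (_ , _ , le))))    → +-≰ 0 le
  ; (inj₁ (inj₂ (inj₂ (e , _))))         → j≢n-2 e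
  ; (inj₂ (_ , ())) }) (sym (≢⇒≡ᵇ-false j≢n-2))

-- At p = 2 + t the correction cancels the spurious neighbour j = 2 + p = n; at p = 1 + t it adds the fork edge to n.
forkCorrection : ℕ → ℕ → Bool
forkCorrection t p = (p ≡ᵇ 2 + t) xor (p ≡ᵇ 1 + t)

middleAdjacency : ℕ → ℕ → ℕ → Bool
middleAdjacency t p j = ((j ≡ᵇ p) xor (j ≡ᵇ 2 + p)) xor (forkCorrection t p ∧ (j ≡ᵇ 4 + t))

module _ (t p : ℕ) (p≤ : p ≤ 2 + t) where

  private
    n = 4 + t

  adjacent-middle-self : adjacent n (suc p) p ≡ middleAdjacency t p p
  adjacent-middle-self = trans (adjacent-complete n (suc p) p (predecessor p p≤)) (sym rhs)
    where
    predecessor : ∀ p → p ≤ 2 + t → Adjacent n (suc p) p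
    predecessor zero    _  = inj₂ (refl , refl)
    predecessor (suc p) p≤ = inj₁ (inj₂ (inj₁ (s≤s z≤n , refl , s≤s p≤)))
    rhs : middleAdjacency t p p ≡ true
    rhs rewrite ≡ᵇ-refl p | <⇒≡ᵇ-false {p} {2 + p} (s≤s (n≤1+n p))
              | <⇒≡ᵇ-false {p} {4 + t} (s≤s (≤-trans p≤ (n≤1+n _))) | ∧-zeroʳ (forkCorrection t p) = refl

  adjacent-middle-next : adjacent n (suc p) (2 + p) ≡ middleAdjacency t p (2 + p)
  adjacent-middle-next with p ≟ 2 + t
  ... | yes refl = trans (adjacent-false n (3 + t) (4 + t) λ
        { (inj₁ (inj₁ (inj₁ (_ , _ , le)))) → +-≰ 0 le
        ; (inj₁ (inj₁ (inj₂ (e , _))))      → +-≢ 0 e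
        ; (inj₁ (inj₂ (inj₁ (_ , e , _))))  → +-≢ 1 (sym e)
        ; (inj₁ (inj₂ (inj₂ (e , _))))      → +-≢ 1 e
        ; (inj₂ (() , _)) }) (sym rhs)
    where
    rhs : middleAdjacency t (2 + t) (4 + t) ≡ false
    rhs rewrite ≡ᵇ-refl t | +-≡ᵇ-false 1 t | +-≡ᵇ-false 0 t = refl
  ... | no p≢n-2 =
    trans (adjacent-complete n (suc p) (2 + p) (inj₁ (inj₁ (inj₁ (s≤s z≤n , refl , s≤s (≤∧≢⇒< p≤ p≢n-2)))))) (sym rhs)
    where
    rhs : middleAdjacency t p (2 + p) ≡ true
    rhs rewrite >⇒≡ᵇ-false {2 + p} {p} (s≤s (n≤1+n p)) | ≡ᵇ-refl p
              | ≢⇒≡ᵇ-false {2 + p} {4 + t} (p≢n-2 ∘ suc-injective ∘ suc-injective) | ∧-zeroʳ (p ≡ᵇ 1 + t) = refl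

  adjacent-middle-fork : 4 + t ≢ p → 4 + t ≢ 2 + p → adjacent n (suc p) (4 + t) ≡ middleAdjacency t p (4 + t)
  adjacent-middle-fork n≢p n≢p+2 with p ≟ 1 + t
  ... | yes refl = trans (adjacent-complete n (2 + t) (4 + t) (inj₁ (inj₁ (inj₂ (refl , refl))))) (sym rhs)
    where
    rhs : middleAdjacency t (1 + t) (4 + t) ≡ true
    rhs rewrite ≡ᵇ-refl t | +-≡ᵇ-false 2 t | +-≡ᵇ-false 0 t | ≡ᵇ-+-false 0 t = refl
  ... | no p≢n-3 = trans (adjacent-false n (suc p) (4 + t) λ
        { (inj₁ (inj₁ (inj₁ (_ , _ , le)))) → +-≰ 0 le
        ; (inj₁ (inj₁ (inj₂ (e , _))))      → p≢n-3 (suc-injective e)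
        ; (inj₁ (inj₂ (inj₁ (_ , e , _))))  → +-≰ 1 (subst (_≤ 2 + t) (suc-injective e) p≤)
        ; (inj₁ (inj₂ (inj₂ (e , _))))      → +-≢ 1 e
        ; (inj₂ (() , _)) }) (sym rhs)
    where
    rhs : middleAdjacency t p (4 + t) ≡ false
    rhs rewrite ≢⇒≡ᵇ-false n≢p | ≢⇒≡ᵇ-false n≢p+2 | ≡ᵇ-refl t
              | ≢⇒≡ᵇ-false {p} {2 + t} (n≢p+2 ∘ cong (2 +_) ∘ sym) | ≢⇒≡ᵇ-false p≢n-3 = refl

  adjacent-middle-other : ∀ {j} → j ≢ p → j ≢ 2 + p → j ≢ 4 + t → adjacent n (suc p) j ≡ middleAdjacency t p j
  adjacent-middle-other {j} j≢p j≢p+2 j≢n = trans (adjacent-false n (suc p) j λ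
        { (inj₁ (inj₁ (inj₁ (_ , e , _)))) → j≢p+2 e
        ; (inj₁ (inj₁ (inj₂ (_ , e))))      → j≢n e
        ; (inj₁ (inj₂ (inj₁ (_ , e , _))))  → j≢p (sym (suc-injective e))
        ; (inj₁ (inj₂ (inj₂ (_ , e))))      → +-≰ 0 (subst (_≤ 2 + t) (suc-injective e) p≤)
        ; (inj₂ (refl , refl))               → j≢p refl }) (sym rhs)
    where
    rhs : middleAdjacency t p j ≡ false
    rhs rewrite ≢⇒≡ᵇ-false j≢p | ≢⇒≡ᵇ-false j≢p+2 | ≢⇒≡ᵇ-false j≢n
              | ∧-zeroʳ (forkCorrection t p) = refl

  adjacent-middle : ∀ j → adjacent n (suc p) j ≡ middleAdjacency t p j
  adjacent-middle j with j ≟ p | j ≟ 2 + p | j ≟ 4 + t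
  ... | yes refl | _        | _        = adjacent-middle-self
  ... | no _     | yes refl | _        = adjacent-middle-next
  ... | no j≢p   | no j≢p+2 | yes refl = adjacent-middle-fork j≢p j≢p+2
  ... | no j≢p   | no j≢p+2 | no j≢n   = adjacent-middle-other j≢p j≢p+2 j≢n

neighbourSum : ℕ → ℕ → (ℕ → Bool) → Bool
neighbourSum n a L = xorSum (suc n) (λ j → adjacent n a j ∧ L j)

move-toggles : ∀ n i d {a δ} → toℕ i ≡ a → neighbourSum n a (at d) ≡ δ →
  ∀ x → at (T (Y n) i d) x ≡ at d x xor ((x ≡ᵇ a) ∧ δ)
move-toggles n i d refl refl = at-T (Y n) (adjacent n) (λ _ _ → refl) i d

-- The difference sequence

diff : ℕ → (ℕ → Bool) → ℕ → Bool
diff n L j = (L j xor L (suc j)) xor ((j ≡ᵇ n ∸ 2) ∧ L n)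

diff-cong : ∀ n {L L′ : ℕ → Bool} → (∀ x → x < suc n → L x ≡ L′ x) →
  ∀ j → j < n → diff n L j ≡ diff n L′ j
diff-cong n h j j<n = cong₂ _xor_ (cong₂ _xor_ (h j (≤-trans j<n (n≤1+n n))) (h (suc j) (s≤s j<n)))
                                  (cong ((j ≡ᵇ n ∸ 2) ∧_) (h n ≤-refl))

diff-xor : ∀ n (A B : ℕ → Bool) j → diff n (λ x → A x xor B x) j ≡ diff n A j xor diff n B j
diff-xor n A B j = solve 7 (λ aj asj an bj bsj bn m →
    ((aj :+ bj) :+ (asj :+ bsj)) :+ (m :* (an :+ bn)) := ((aj :+ asj) :+ (m :* an)) :+ ((bj :+ bsj) :+ (m :* bn))) refl
  (A j) (A (suc j)) (A n) (B j) (B (suc j)) (B n) (j ≡ᵇ n ∸ 2)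
  where open xor-∧-Solver

diff-vanishing : ∀ n L j → L n ≡ false → diff n L j ≡ L j xor L (suc j)
diff-vanishing n L j Ln≡false =
  trans (cong (λ b → (L j xor L (suc j)) xor ((j ≡ᵇ n ∸ 2) ∧ b)) Ln≡false)
        (trans (cong ((L j xor L (suc j)) xor_) (∧-zeroʳ _)) (xor-identityʳ _))

neighbourSum-first : ∀ t L → neighbourSum (4 + t) 0 L ≡ false
neighbourSum-first t L =
  trans (xorSum-cong (5 + t) (λ j → cong (_∧ L j) (adjacent-first t j))) (xorSum-false (5 + t))

neighbourSum-middle : ∀ t p L → p ≤ 2 + t →
  neighbourSum (4 + t) (suc p) L ≡ diff (4 + t) L p xor diff (4 + t) L (suc p)
neighbourSum-middle t p L p≤ = begin
  neighbourSum (4 + t) (suc p) L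
    ≡⟨ xorSum-cong (5 + t) (λ j → trans (cong (_∧ L j) (adjacent-middle t p p≤ j))
                                        (distrib (j ≡ᵇ p) (j ≡ᵇ 2 + p) c (j ≡ᵇ 4 + t) (L j))) ⟩
  xorSum (5 + t) (λ j → (point p j xor point (2 + p) j) xor ((j ≡ᵇ 4 + t) ∧ (c ∧ L j)))
    ≡⟨ xorSum-xor (5 + t) (λ j → point p j xor point (2 + p) j) (λ j → (j ≡ᵇ 4 + t) ∧ (c ∧ L j)) ⟩
  xorSum (5 + t) (λ j → point p j xor point (2 + p) j) xor xorSum (5 + t) (λ j → (j ≡ᵇ 4 + t) ∧ (c ∧ L j))
    ≡⟨ cong₂ _xor_ (xorSum-xor (5 + t) (point p) (point (2 + p)))
                   (xorSum-point (5 + t) (4 + t) (λ j → c ∧ L j) ≤-refl) ⟩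
  (xorSum (5 + t) (point p) xor xorSum (5 + t) (point (2 + p))) xor (c ∧ L (4 + t))
    ≡⟨ cong (_xor (c ∧ L (4 + t))) (cong₂ _xor_ (xorSum-point (5 + t) p L (s≤s (≤-trans p≤ (≤-trans (n≤1+n _) (n≤1+n _)))))
                                                  (xorSum-point (5 + t) (2 + p) L (s≤s (s≤s (s≤s p≤))))) ⟩
  (L p xor L (2 + p)) xor (c ∧ L (4 + t))
    ≡⟨ telescope (L p) (L (suc p)) (L (2 + p)) (p ≡ᵇ 2 + t) (p ≡ᵇ 1 + t) (L (4 + t)) ⟩
  diff (4 + t) L p xor diff (4 + t) L (suc p) ∎
  where
  open ≡-Reasoning
  open xor-∧-Solver
  c = forkCorrection t p
  point : ℕ → ℕ → Bool
  point a j = (j ≡ᵇ a) ∧ L j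
  distrib : ∀ a b c e l → (((a xor b) xor (c ∧ e)) ∧ l) ≡ ((a ∧ l) xor (b ∧ l)) xor (e ∧ (c ∧ l))
  distrib = solve 5 (λ a b c e l → ((a :+ b) :+ (c :* e)) :* l := ((a :* l) :+ (b :* l)) :+ (e :* (c :* l))) refl
  telescope : ∀ a b c x y l → (a xor c) xor ((x xor y) ∧ l) ≡ ((a xor b) xor (x ∧ l)) xor ((b xor c) xor (y ∧ l))
  telescope = solve 6 (λ a b c x y l → (a :+ c) :+ ((x :+ y) :* l) := ((a :+ b) :+ (x :* l)) :+ ((b :+ c) :+ (y :* l))) refl

neighbourSum-last : ∀ t L → neighbourSum (4 + t) (4 + t) L ≡ diff (4 + t) L (2 + t) xor diff (4 + t) L (3 + t)
neighbourSum-last t L = begin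
  neighbourSum (4 + t) (4 + t) L
    ≡⟨ xorSum-cong (5 + t) (λ j → cong (_∧ L j) (adjacent-last t j)) ⟩
  xorSum (5 + t) (λ j → (j ≡ᵇ 2 + t) ∧ L j)
    ≡⟨ xorSum-point (5 + t) (2 + t) L (s≤s (≤-trans (n≤1+n _) (n≤1+n _))) ⟩
  L (2 + t)
    ≡⟨ telescope (L (2 + t)) (L (3 + t)) (L (4 + t)) ⟩
  ((L (2 + t) xor L (3 + t)) xor (true ∧ L (4 + t))) xor ((L (3 + t) xor L (4 + t)) xor (false ∧ L (4 + t)))
    ≡⟨ sym (cong₂ (λ x y → ((L (2 + t) xor L (3 + t)) xor (x ∧ L (4 + t)))
                         xor ((L (3 + t) xor L (4 + t)) xor (y ∧ L (4 + t))))
                  (≡ᵇ-refl t) (+-≡ᵇ-false 0 t)) ⟩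
  diff (4 + t) L (2 + t) xor diff (4 + t) L (3 + t) ∎
  where
  open ≡-Reasoning
  open xor-∧-Solver
  telescope : ∀ a b c → a ≡ ((a xor b) xor (true ∧ c)) xor ((b xor c) xor (false ∧ c))
  telescope = solve 3 (λ a b c → a := ((a :+ b) :+ c) :+ ((b :+ c) :+ con false)) refl

touches : ℕ → ℕ → ℕ → Bool
touches n a j = ((j ≡ᵇ a) xor (suc j ≡ᵇ a)) xor ((j ≡ᵇ n ∸ 2) ∧ (n ≡ᵇ a))

diff-toggle : ∀ n L a δ j → diff n (λ x → L x xor ((x ≡ᵇ a) ∧ δ)) j ≡ diff n L j xor (δ ∧ touches n a j)
diff-toggle n L a δ j = solve 8 (λ lj lsj ln ea esa m ena d →
    ((lj :+ (ea :* d)) :+ (lsj :+ (esa :* d))) :+ (m :* (ln :+ (ena :* d)))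
    := ((lj :+ lsj) :+ (m :* ln)) :+ (d :* ((ea :+ esa) :+ (m :* ena)))) refl
  (L j) (L (suc j)) (L n) (j ≡ᵇ a) (suc j ≡ᵇ a) (j ≡ᵇ n ∸ 2) (n ≡ᵇ a) δ
  where open xor-∧-Solver

touches-middle : ∀ t p j → p ≤ 2 + t → touches (4 + t) (suc p) j ≡ (j ≡ᵇ p) xor (j ≡ᵇ suc p)
touches-middle t p j p≤ rewrite >⇒≡ᵇ-false {3 + t} {p} (s≤s p≤) | ∧-zeroʳ (j ≡ᵇ 2 + t) =
  trans (xor-identityʳ _) (xor-comm (j ≡ᵇ suc p) (j ≡ᵇ p))

touches-last : ∀ t j → j < 4 + t → touches (4 + t) (4 + t) j ≡ (j ≡ᵇ 2 + t) xor (j ≡ᵇ 3 + t)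
touches-last t j j< rewrite <⇒≡ᵇ-false j< | ≡ᵇ-refl t | ∧-identityʳ (j ≡ᵇ 2 + t) =
  xor-comm (j ≡ᵇ 3 + t) (j ≡ᵇ 2 + t)

Classification : (n : ℕ) → List (Labeling (suc n)) → Set
Classification n R =
    (Σ (Fin (n + 3) → Labeling (suc n)) λ f →
        (∀ i j → f i ∼⟨ Y n ⟩ f j → i ≡ j)
      × (∀ d → ∃ λ i → d ∼⟨ Y n ⟩ f i))
    × (length R ≡ n + 3
      × (∀ i j → lookup R i ∼⟨ Y n ⟩ lookup R j → i ≡ j)
      × (∀ d → ∃ λ i → d ∼⟨ Y n ⟩ lookup R i)
      × (∀ i d → lookup R i ∼⟨ Y n ⟩ d → weight (lookup R i) ≤ weight d))

lookup-injective : ∀ {A B : Set} (f : A → B) xs → Unique (map f xs) →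
  ∀ i j → f (lookup xs i) ≡ f (lookup xs j) → i ≡ j
lookup-injective f (x ∷ xs) (x∉ ∷ unique) fzero    fzero    _ = refl
lookup-injective f (x ∷ xs) (x∉ ∷ unique) fzero    (fsuc j) e = ⊥-elim (All.lookup x∉ (∈-map⁺ f (∈-lookup j)) e)
lookup-injective f (x ∷ xs) (x∉ ∷ unique) (fsuc i) fzero    e = ⊥-elim (All.lookup x∉ (∈-map⁺ f (∈-lookup i)) (sym e))
lookup-injective f (x ∷ xs) (x∉ ∷ unique) (fsuc i) (fsuc j) e = cong fsuc (lookup-injective f xs unique i j e)

minWeight : ℕ × Bool → ℕ
minWeight (zero , true) = 2
minWeight (w    , _)    = ⌈ w /2⌉

minWeight-≤ : ∀ w b W → ⌈ w /2⌉ ≤ W → (w ≡ 0 → b ≡ true → 2 ≤ W) → minWeight (w , b) ≤ W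
minWeight-≤ zero    true  W _    special = special refl refl
minWeight-≤ zero    false W half _       = half
minWeight-≤ (suc w) b     W half _       = half

minWeight-untagged : ∀ w → minWeight (w , false) ≡ ⌈ w /2⌉
minWeight-untagged zero    = refl
minWeight-untagged (suc w) = refl

module _ (t : ℕ) where

  Yₜ : Diagram (5 + t)
  Yₜ = Y (4 + t)

  σ : Labeling (5 + t) → ℕ → Bool
  σ d = diff (4 + t) (at d)

  diffs : Labeling (5 + t) → List Bool
  diffs d = applyUpTo (σ d) (4 + t)

  σ-move : ∀ i d {a} q → toℕ i ≡ a →
    (∀ j → j < 4 + t → touches (4 + t) a j ≡ (j ≡ᵇ q) xor (j ≡ᵇ suc q)) →
    neighbourSum (4 + t) a (at d) ≡ σ d q xor σ d (suc q) →
    ∀ j → j < 4 + t → σ (T Yₜ i d) j ≡ swapAt q (σ d) j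
  σ-move i d {a} q i≡a hTouch hSum j j< = begin
    σ (T Yₜ i d) j                                 ≡⟨ diff-cong (4 + t) (λ x _ → move-toggles (4 + t) i d i≡a hSum x) j j< ⟩
    diff (4 + t) (λ x → at d x xor ((x ≡ᵇ a) ∧ δ)) j ≡⟨ diff-toggle (4 + t) (at d) a δ j ⟩
    σ d j xor (δ ∧ touches (4 + t) a j)             ≡⟨ cong (λ z → σ d j xor (δ ∧ z)) (hTouch j j<) ⟩
    swapAt q (σ d) j                                ∎
    where
    open ≡-Reasoning
    δ = σ d q xor σ d (suc q)

  σ-move-middle : ∀ i d p → toℕ i ≡ suc p → p ≤ 2 + t → ∀ j → j < 4 + t → σ (T Yₜ i d) j ≡ swapAt p (σ d) j
  σ-move-middle i d p i≡ p≤ = σ-move i d p i≡ (λ j _ → touches-middle t p j p≤) (neighbourSum-middle t p (at d) p≤)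

  σ-move-last : ∀ i d → toℕ i ≡ 4 + t → ∀ j → j < 4 + t → σ (T Yₜ i d) j ≡ swapAt (2 + t) (σ d) j
  σ-move-last i d i≡ = σ-move i d (2 + t) i≡ (touches-last t) (neighbourSum-last t (at d))

  diffs-move-middle : ∀ i d p → toℕ i ≡ suc p → p ≤ 2 + t → diffs (T Yₜ i d) ≡ swapAdjacent p (diffs d)
  diffs-move-middle i d p i≡ p≤ =
    trans (applyUpTo-cong (4 + t) (σ-move-middle i d p i≡ p≤)) (applyUpTo-swapAt (4 + t) p (σ d) (s≤s (s≤s p≤)))

  diffs-move-last : ∀ i d → toℕ i ≡ 4 + t → diffs (T Yₜ i d) ≡ swapAdjacent (2 + t) (diffs d)
  diffs-move-last i d i≡ =
    trans (applyUpTo-cong (4 + t) (σ-move-last i d i≡)) (applyUpTo-swapAt (4 + t) (2 + t) (σ d) ≤-refl)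

  move-first : ∀ i d → toℕ i ≡ 0 → T Yₜ i d ≡ d
  move-first i d i≡ = at-injective _ _ λ x →
    trans (move-toggles (4 + t) i d i≡ (neighbourSum-first t (at d)) x)
          (trans (cong (at d x xor_) (∧-zeroʳ (x ≡ᵇ 0))) (xor-identityʳ _))

  at-last-move-middle : ∀ i d p → toℕ i ≡ suc p → p ≤ 2 + t → at (T Yₜ i d) (4 + t) ≡ at d (4 + t)
  at-last-move-middle i d p i≡ p≤ =
    trans (move-toggles (4 + t) i d i≡ refl (4 + t))
          (trans (cong (λ z → at d (4 + t) xor (z ∧ neighbourSum (4 + t) (suc p) (at d)))
                       (>⇒≡ᵇ-false {4 + t} {suc p} (s≤s (s≤s p≤))))
                 (xor-identityʳ _))

  at-last-move-last : ∀ i d → toℕ i ≡ 4 + t → at (T Yₜ i d) (4 + t) ≡ at d (4 + t) xor (σ d (2 + t) xor σ d (3 + t))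
  at-last-move-last i d i≡ =
    trans (move-toggles (4 + t) i d i≡ (neighbourSum-last t (at d)) (4 + t))
          (cong (λ z → at d (4 + t) xor (z ∧ (σ d (2 + t) xor σ d (3 + t)))) (≡ᵇ-refl (4 + t)))

  jumps : Labeling (5 + t) → ℕ
  jumps d = trues (diffs d)

  extreme : ℕ → Bool
  extreme w = (w ≡ᵇ 0) ∨ (w ≡ᵇ 4 + t)

  invariant : Labeling (5 + t) → ℕ × Bool
  invariant d = jumps d , extreme (jumps d) ∧ at d (4 + t)

  jumps≤ : ∀ d → jumps d ≤ 4 + t
  jumps≤ d = ≤-trans (trues≤length (diffs d)) (≤-reflexive (length-applyUpTo (σ d) (4 + t)))

  extreme-cases : ∀ {w} → extreme w ≡ true → w ≡ 0 ⊎ w ≡ 4 + t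
  extreme-cases {w} e with w ≡ᵇ 0 in w≡0
  ... | true  = inj₁ (≡ᵇ-true⇒≡ w≡0)
  ... | false = inj₂ (≡ᵇ-true⇒≡ e)

  σ-extreme : ∀ d → extreme (jumps d) ≡ true → ∀ j → j < 4 + t → σ d j ≡ (jumps d ≡ᵇ 4 + t)
  σ-extreme d e j j< with extreme-cases e
  ... | inj₁ w≡0 = trans (trues≡0⇒false (4 + t) (σ d) w≡0 j j<) (cong (_≡ᵇ 4 + t) (sym w≡0))
  ... | inj₂ w≡n = trans (trues≡N⇒true (4 + t) (σ d) w≡n j j<)
                         (trans (sym (≡ᵇ-refl (4 + t))) (cong (_≡ᵇ 4 + t) (sym w≡n)))

  data Vertex : ℕ → Set where
    first  : Vertex 0
    middle : ∀ p → p ≤ 2 + t → Vertex (suc p)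
    last   : Vertex (4 + t)

  vertex : (i : Fin (5 + t)) → Vertex (toℕ i)
  vertex i = classify (toℕ i) (≤-pred (toℕ<n i))
    where
    classify : ∀ a → a ≤ 4 + t → Vertex a
    classify zero    _ = first
    classify (suc p) (s≤s p≤) with m≤n⇒m<n∨m≡n p≤
    ... | inj₁ (s≤s p<) = middle p p<
    ... | inj₂ refl     = last

  invariant-move : ∀ i d → invariant (T Yₜ i d) ≡ invariant d
  invariant-move i d = go (toℕ i) refl (vertex i)
    where
    go : ∀ a → toℕ i ≡ a → Vertex a → invariant (T Yₜ i d) ≡ invariant d
    go .0 i≡ first = cong invariant (move-first i d i≡)
    go .(suc p) i≡ (middle p p≤) = cong₂ (λ w b → w , extreme w ∧ b) sameJumps (at-last-move-middle i d p i≡ p≤)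
      where
      sameJumps : jumps (T Yₜ i d) ≡ jumps d
      sameJumps = trans (cong trues (diffs-move-middle i d p i≡ p≤)) (trues-swapAdjacent p (diffs d))
    go .(4 + t) i≡ last = cong₂ _,_ sameJumps (trans (cong (λ w → extreme w ∧ at (T Yₜ i d) (4 + t)) sameJumps) sameTag)
      where
      sameJumps : jumps (T Yₜ i d) ≡ jumps d
      sameJumps = trans (cong trues (diffs-move-last i d i≡)) (trues-swapAdjacent (2 + t) (diffs d))
      sameTag : extreme (jumps d) ∧ at (T Yₜ i d) (4 + t) ≡ extreme (jumps d) ∧ at d (4 + t)
      sameTag with extreme (jumps d) in e
      ... | false = refl
      ... | true  = begin
        at (T Yₜ i d) (4 + t)                       ≡⟨ at-last-move-last i d i≡ ⟩
        at d (4 + t) xor (σ d (2 + t) xor σ d (3 + t)) ≡⟨ cong (at d (4 + t) xor_) flat ⟩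
        at d (4 + t) xor false                      ≡⟨ xor-identityʳ _ ⟩
        at d (4 + t)                                ∎
        where
        open ≡-Reasoning
        flat : σ d (2 + t) xor σ d (3 + t) ≡ false
        flat = trans (cong₂ _xor_ (σ-extreme d e (2 + t) (s≤s (s≤s (s≤s (n≤1+n _))))) (σ-extreme d e (3 + t) ≤-refl))
                     (xor-same (jumps d ≡ᵇ 4 + t))

  invariant-∼ : ∀ {d e} → d ∼⟨ Yₜ ⟩ e → invariant d ≡ invariant e
  invariant-∼ ε                               = refl
  invariant-∼ (fwd (move i d) ◅ steps) = trans (sym (invariant-move i d)) (invariant-∼ steps)
  invariant-∼ (bwd (move i d) ◅ steps) = trans (invariant-move i d) (invariant-∼ steps)

  -- Completeness of the invariant

  diffs-determine : ∀ d e → diffs d ≡ diffs e → at d (4 + t) ≡ at e (4 + t) → d ≡ e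
  diffs-determine d e sameDiffs sameLast = at-injective d e (λ j → agree (4 + t) j (m≤m+n (4 + t) j))
    where
    -- downward induction from position n, where d and e agree by assumption
    agree : ∀ k j → 4 + t ≤ k + j → at d j ≡ at e j
    agree zero j n≤j with m≤n⇒m<n∨m≡n n≤j
    ... | inj₁ n<j  = trans (at-beyond d j n<j) (sym (at-beyond e j n<j))
    ... | inj₂ refl = sameLast
    agree (suc k) j n≤ with 4 + t ≤? k + j
    ... | yes n≤′ = agree k j n≤′
    ... | no n≰ = xor-cancelʳ (at d j) (at e j) (rest d) (begin
      at d j xor rest d ≡⟨ sym (xor-assoc (at d j) _ _) ⟩
      σ d j             ≡⟨ applyUpTo-injective (4 + t) {σ d} {σ e} sameDiffs j j<n ⟩
      σ e j             ≡⟨ xor-assoc (at e j) _ _ ⟩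
      at e j xor rest e ≡⟨ cong (at e j xor_) (sym sameRest) ⟩
      at e j xor rest d ∎)
      where
      open ≡-Reasoning
      j<n : j < 4 + t
      j<n = ≤-trans (s≤s (m≤n+m j k)) (≰⇒> n≰)
      rest : Labeling (5 + t) → Bool
      rest x = at x (suc j) xor ((j ≡ᵇ 2 + t) ∧ at x (4 + t))
      sameRest : rest d ≡ rest e
      sameRest = cong₂ (λ a b → a xor ((j ≡ᵇ 2 + t) ∧ b))
        (agree k (suc j) (subst (4 + t ≤_) (sym (+-suc k j)) n≤)) sameLast

  lift-swaps : ∀ {xs ys} → Star Swap xs ys → ∀ d → diffs d ≡ xs → ∃ λ e → d ∼⟨ Yₜ ⟩ e × diffs e ≡ ys
  lift-swaps ε d d↦xs = d , ε , d↦xs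
  lift-swaps ((q , q< , refl) ◅ rest) d refl =
    let e , steps , e↦ys = lift-swaps rest (T Yₜ i d) (diffs-move-middle i d q i≡ q≤)
    in  e , fwd (move i d) ◅ steps , e↦ys
    where
    q<n : suc q < 4 + t
    q<n = subst (suc q <_) (length-applyUpTo (σ d) (4 + t)) q<
    q≤ : q ≤ 2 + t
    q≤ = ≤-pred (≤-pred q<n)
    i : Fin (5 + t)
    i = fromℕ< (≤-trans q<n (n≤1+n _))
    i≡ : toℕ i ≡ suc q
    i≡ = toℕ-fromℕ< (≤-trans q<n (n≤1+n _))

  flip-last : ∀ d → σ d (2 + t) xor σ d (3 + t) ≡ true →
    ∃ λ e → d ∼⟨ Yₜ ⟩ e × diffs e ≡ diffs d × at e (4 + t) ≡ not (at d (4 + t))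
  flip-last d differ = e , fwd (move i₁ d) ◅ fwd (move i₂ d′) ◅ ε , sameDiffs , flipped
    where
    open ≡-Reasoning
    i₁ i₂ : Fin (5 + t)
    i₁ = fromℕ< {3 + t} (s≤s (n≤1+n _))
    i₂ = fromℕ< {4 + t} ≤-refl
    i₁≡ : toℕ i₁ ≡ 3 + t
    i₁≡ = toℕ-fromℕ< (s≤s (n≤1+n _))
    i₂≡ : toℕ i₂ ≡ 4 + t
    i₂≡ = toℕ-fromℕ< ≤-refl
    d′ e : Labeling (5 + t)
    d′ = T Yₜ i₁ d
    e  = T Yₜ i₂ d′
    sameDiffs : diffs e ≡ diffs d
    sameDiffs = begin
      diffs e
        ≡⟨ diffs-move-last i₂ d′ i₂≡ ⟩
      swapAdjacent (2 + t) (diffs d′)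
        ≡⟨ cong (swapAdjacent (2 + t)) (diffs-move-middle i₁ d (2 + t) i₁≡ ≤-refl) ⟩
      swapAdjacent (2 + t) (swapAdjacent (2 + t) (diffs d))
        ≡⟨ swapAdjacent-involutive (2 + t) (diffs d) ⟩
      diffs d ∎
    stillDiffer : σ d′ (2 + t) xor σ d′ (3 + t) ≡ true
    stillDiffer = begin
      σ d′ (2 + t) xor σ d′ (3 + t)
        ≡⟨ cong₂ _xor_ (σ-move-middle i₁ d (2 + t) i₁≡ ≤-refl (2 + t) (s≤s (n≤1+n _)))
                       (σ-move-middle i₁ d (2 + t) i₁≡ ≤-refl (3 + t) ≤-refl) ⟩
      swapAt (2 + t) (σ d) (2 + t) xor swapAt (2 + t) (σ d) (3 + t) ≡⟨ swapAt-preserves-xor (2 + t) (σ d) ⟩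
      σ d (2 + t) xor σ d (3 + t)                                   ≡⟨ differ ⟩
      true                                                          ∎
    flipped : at e (4 + t) ≡ not (at d (4 + t))
    flipped = begin
      at e (4 + t)
        ≡⟨ at-last-move-last i₂ d′ i₂≡ ⟩
      at d′ (4 + t) xor (σ d′ (2 + t) xor σ d′ (3 + t))
        ≡⟨ cong₂ _xor_ (at-last-move-middle i₁ d (2 + t) i₁≡ ≤-refl) stillDiffer ⟩
      at d (4 + t) xor true
        ≡⟨ xor-comm (at d (4 + t)) true ⟩
      not (at d (4 + t)) ∎

  σ-from-diffs : ∀ d {xs} → diffs d ≡ xs → ∀ j → j < 4 + t → σ d j ≡ nth xs j
  σ-from-diffs d d↦xs j j< = trans (sym (nth-applyUpTo (4 + t) (σ d) j j<)) (cong (λ xs → nth xs j) d↦xs)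

  staircase : ℕ → List Bool
  staircase w = (replicate w true ++ replicate (2 + t ∸ w) false) ++ true ∷ false ∷ []

  module _ {w} (w≤ : w ≤ 2 + t) where

    length-stairs : length (replicate w true ++ replicate (2 + t ∸ w) false) ≡ 2 + t
    length-stairs = trans (length-++ (replicate w true))
      (trans (cong₂ _+_ (length-replicate w) (length-replicate (2 + t ∸ w))) (m+[n∸m]≡n w≤))

    length-staircase : length (staircase w) ≡ 4 + t
    length-staircase = trans (length-++ (replicate w true ++ _)) (trans (cong (_+ 2) length-stairs) (+-comm (2 + t) 2))

    staircase-end : nth (staircase w) (2 + t) xor nth (staircase w) (3 + t) ≡ true
    staircase-end = cong₂ _xor_ (entry 0 true refl) (entry 1 false refl)
      where
      entry : ∀ k b → nth (true ∷ false ∷ []) k ≡ b → nth (staircase w) (k + (2 + t)) ≡ b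
      entry k b e = trans (cong (nth (staircase w)) (trans (+-comm k (2 + t)) (cong (_+ k) (sym length-stairs))))
                          (trans (nth-++ (replicate w true ++ _) _ k) e)

  trues-staircase : ∀ w → trues (staircase w) ≡ suc w
  trues-staircase w = begin
    trues (staircase w)
      ≡⟨ trues-++ (replicate w true ++ replicate (2 + t ∸ w) false) (true ∷ false ∷ []) ⟩
    trues (replicate w true ++ replicate (2 + t ∸ w) false) + 1
      ≡⟨ cong (_+ 1) (trans (trues-++ (replicate w true) _)
                            (cong₂ _+_ (trues-replicate-true w) (trues-replicate-false (2 + t ∸ w)))) ⟩
    (w + 0) + 1
      ≡⟨ trans (cong (_+ 1) (+-identityʳ w)) (+-comm w 1) ⟩
    suc w ∎
    where open ≡-Reasoning

  sort-to-staircase : ∀ d w → w ≤ 2 + t → jumps d ≡ suc w → ∃ λ e → d ∼⟨ Yₜ ⟩ e × diffs e ≡ staircase w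
  sort-to-staircase d w w≤ jd = lift-swaps
    (swaps-connect (diffs d) (staircase w) (trans (length-applyUpTo (σ d) (4 + t)) (sym (length-staircase w≤)))
                   (trans jd (sym (trues-staircase w))))
    d refl

  connect-inner : ∀ d e w → w ≤ 2 + t → jumps d ≡ suc w → jumps e ≡ suc w → d ∼⟨ Yₜ ⟩ e
  connect-inner d e w w≤ jd je =
    let d₁ , d∼d₁ , d₁↦ = sort-to-staircase d w w≤ jd
        e₁ , e∼e₁ , e₁↦ = sort-to-staircase e w w≤ je
    in  d∼d₁ ◅◅ connect-staircase d₁ e₁ d₁↦ e₁↦ ◅◅ EqClosure.symmetric (Move Yₜ) e∼e₁
    where
    connect-staircase : ∀ d₁ e₁ → diffs d₁ ≡ staircase w → diffs e₁ ≡ staircase w → d₁ ∼⟨ Yₜ ⟩ e₁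
    connect-staircase d₁ e₁ d₁↦ e₁↦ with at d₁ (4 + t) ≟ᴮ at e₁ (4 + t)
    ... | yes sameLast = subst (d₁ ∼⟨ Yₜ ⟩_) (diffs-determine d₁ e₁ (trans d₁↦ (sym e₁↦)) sameLast) ε
    ... | no differ =
      let d₂ , d₁∼d₂ , d₂↦ , flipped = flip-last d₁ endDiffers
      in  d₁∼d₂ ◅◅ subst (d₂ ∼⟨ Yₜ ⟩_)
            (diffs-determine d₂ e₁ (trans d₂↦ (trans d₁↦ (sym e₁↦))) (trans flipped (sym (¬-not (differ ∘ sym))))) ε
      where
      endDiffers : σ d₁ (2 + t) xor σ d₁ (3 + t) ≡ true
      endDiffers = trans (cong₂ _xor_ (σ-from-diffs d₁ d₁↦ (2 + t) (s≤s (n≤1+n _)))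
                                      (σ-from-diffs d₁ d₁↦ (3 + t) ≤-refl))
                         (staircase-end w≤)

  connect-extreme : ∀ d e → invariant d ≡ invariant e → extreme (jumps d) ≡ true → d ≡ e
  connect-extreme d e same ext = diffs-determine d e sameDiffs sameLast
    where
    sameJumps : jumps d ≡ jumps e
    sameJumps = cong proj₁ same
    ext′ : extreme (jumps e) ≡ true
    ext′ = trans (cong extreme (sym sameJumps)) ext
    sameDiffs : diffs d ≡ diffs e
    sameDiffs = applyUpTo-cong (4 + t) λ j j< →
      trans (σ-extreme d ext j j<) (trans (cong (_≡ᵇ 4 + t) sameJumps) (sym (σ-extreme e ext′ j j<)))
    sameLast : at d (4 + t) ≡ at e (4 + t)
    sameLast = trans (cong (_∧ at d (4 + t)) (sym ext)) (trans (cong proj₂ same) (cong (_∧ at e (4 + t)) ext′))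

  inner-jumps : ∀ w → w ≤ 4 + t → extreme w ≡ false → ∃ λ v → v ≤ 2 + t × w ≡ suc v
  inner-jumps (suc v) v< ext = v , ≤-pred (≤-pred (≤∧≢⇒< v< (≡ᵇ-false⇒≢ {suc v} {4 + t} ext))) , refl

  invariant-complete : ∀ d e → invariant d ≡ invariant e → d ∼⟨ Yₜ ⟩ e
  invariant-complete d e same = by-cases (extreme (jumps d)) refl
    where
    by-cases : ∀ b → extreme (jumps d) ≡ b → d ∼⟨ Yₜ ⟩ e
    by-cases true  ext = subst (d ∼⟨ Yₜ ⟩_) (connect-extreme d e same ext) ε
    by-cases false ext =
      let v , v≤ , jd = inner-jumps (jumps d) (jumps≤ d) ext
      in  connect-inner d e v v≤ jd (trans (sym (cong proj₁ same)) jd)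

  -- Minimal weights

  jumps≤2·weight : ∀ d → jumps d ≤ weight d + weight d
  jumps≤2·weight d = begin
    jumps d
      ≤⟨ count-subadditive (4 + t) (σ d) (λ j → L j xor L (suc j)) (λ j → (j ≡ᵇ 2 + t) ∧ L (4 + t))
                           (λ _ → xor-true⇒) ⟩
    count (4 + t) (λ j → L j xor L (suc j)) + count (4 + t) (λ j → (j ≡ᵇ 2 + t) ∧ L (4 + t))
      ≤⟨ +-mono-≤ (count-subadditive (4 + t) _ L (L ∘ suc) (λ _ → xor-true⇒)) (count-point (4 + t) (2 + t) (L (4 + t))) ⟩
    (count (4 + t) L + count (4 + t) (L ∘ suc)) + bit (L (4 + t))
      ≡⟨ swap-last (count (4 + t) L) (count (4 + t) (L ∘ suc)) (bit (L (4 + t))) ⟩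
    (count (4 + t) L + bit (L (4 + t))) + count (4 + t) (L ∘ suc)
      ≤⟨ +-mono-≤ (≤-reflexive (sym (count-sucʳ (4 + t) L)))
                  (≤-trans (m≤n+m _ (bit (L 0))) (≤-reflexive (sym (count-suc (4 + t) L)))) ⟩
    count (5 + t) L + count (5 + t) L
      ≡⟨ sym (cong₂ _+_ (weight≡count d) (weight≡count d)) ⟩
    weight d + weight d ∎
    where
    open ≤-Reasoning
    L = at d
    swap-last : ∀ a b c → (a + b) + c ≡ (a + c) + b
    swap-last = +-*-Solver.solve 3 (λ a b c → (a :+ b) :+ c := (a :+ c) :+ b) refl
      where open +-*-Solver

  σ-last : ∀ d → σ d (3 + t) ≡ at d (3 + t) xor at d (4 + t)
  σ-last d = trans (cong (λ b → (at d (3 + t) xor at d (4 + t)) xor (b ∧ at d (4 + t))) (+-≡ᵇ-false 0 t)) (xor-identityʳ _)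

  minWeight≤weight : ∀ d → minWeight (invariant d) ≤ weight d
  minWeight≤weight d = minWeight-≤ (jumps d) (extreme (jumps d) ∧ at d (4 + t)) (weight d) half special
    where
    half : ⌈ jumps d /2⌉ ≤ weight d
    half = ≤-trans (⌈n/2⌉-mono (jumps≤2·weight d)) (≤-reflexive (sym (n≡⌈n+n/2⌉ (weight d))))
    special : jumps d ≡ 0 → extreme (jumps d) ∧ at d (4 + t) ≡ true → 2 ≤ weight d
    special j≡0 tag = subst (2 ≤_) (sym (weight≡count d)) (count-two-last (3 + t) (at d) at₃ at₄)
      where
      at₄ : at d (4 + t) ≡ true
      at₄ = proj₂ (∧-true⇒ tag)
      at₃ : at d (3 + t) ≡ true
      at₃ = xor-cancelʳ (at d (3 + t)) true (at d (4 + t))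
        (trans (sym (σ-last d)) (trans (trues≡0⇒false (4 + t) (σ d) j≡0 (3 + t) ≤-refl) (cong (true xor_) (sym at₄))))

  -- Invariants of the listed labelings

  invariant-by-steps : ∀ r (Q : ℕ → Bool) w → (∀ j → j < 5 + t → at r j ≡ Q j) → w ≤ 4 + t →
    (∀ j → j < 4 + t → diff (4 + t) Q j ≡ (j <ᵇ w)) → invariant r ≡ (w , extreme w ∧ Q (4 + t))
  invariant-by-steps r Q w atQ w≤ steps = cong₂ (λ w b → w , extreme w ∧ b) jumps≡w (atQ (4 + t) ≤-refl)
    where
    jumps≡w : jumps r ≡ w
    jumps≡w = trans (cong trues (applyUpTo-cong (4 + t) λ j j< → trans (diff-cong (4 + t) atQ j j<) (steps j j<)))
                    (count-<ᵇ (4 + t) w w≤)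

  invariant-odds : ∀ i → twice i ≤ 4 + t → invariant (ones (4 + t) (odds i)) ≡ (twice i , false)
  invariant-odds i i≤ =
    trans (invariant-by-steps (ones (4 + t) (odds i)) (oddPattern i) (twice i)
            (λ j j< → trans (at-ones (4 + t) (odds i) j j<) (mem-odds i j)) i≤
            (λ j _ → trans (diff-vanishing (4 + t) (oddPattern i) j vanish) (oddPattern-step i j)))
          (cong (twice i ,_) (trans (cong (extreme (twice i) ∧_) vanish) (∧-zeroʳ _)))
    where
    vanish : oddPattern i (4 + t) ≡ false
    vanish = oddPattern-beyond i (4 + t) i≤

  invariant-evens : ∀ i → suc (twice i) ≤ 4 + t → invariant (ones (4 + t) (0 ∷ evens i)) ≡ (suc (twice i) , false)
  invariant-evens i i≤ =
    trans (invariant-by-steps (ones (4 + t) (0 ∷ evens i)) (evenPattern i) (suc (twice i))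
            (λ j j< → trans (at-ones (4 + t) (0 ∷ evens i) j j<) (mem-evens i j)) i≤
            (λ j _ → trans (diff-vanishing (4 + t) (evenPattern i) j vanish) (evenPattern-step i j)))
          (cong (suc (twice i) ,_) (trans (cong (extreme (suc (twice i)) ∧_) vanish) (∧-zeroʳ _)))
    where
    vanish : evenPattern i (4 + t) ≡ false
    vanish = evenPattern-beyond i (4 + t) i≤

  diff-last-pair : ∀ a j → a ≡ 3 + t ⊎ a ≡ 4 + t → j < 4 + t →
    diff (4 + t) (a ≡ᵇ_) j ≡ (j ≡ᵇ 2 + t) xor (j ≡ᵇ 3 + t)
  diff-last-pair _ j (inj₁ refl) j<
    rewrite ≡ᵇ-+-false 0 t | ∧-zeroʳ (j ≡ᵇ 2 + t) | xor-identityʳ ((3 + t ≡ᵇ j) xor (3 + t ≡ᵇ suc j))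
          | ≡ᵇ-sym (3 + t) j | ≡ᵇ-sym (2 + t) j = xor-comm (j ≡ᵇ 3 + t) (j ≡ᵇ 2 + t)
  diff-last-pair _ j (inj₂ refl) j<
    rewrite ≡ᵇ-refl t | ∧-identityʳ (j ≡ᵇ 2 + t) | ≡ᵇ-sym (4 + t) j | <⇒≡ᵇ-false j< | ≡ᵇ-sym (3 + t) j =
      xor-comm (j ≡ᵇ 3 + t) (j ≡ᵇ 2 + t)

  invariant-tail : ∀ S P a → (∀ j → mem S j ≡ P j ∨ (a ≡ᵇ j)) →
    (∀ j → P j xor P (suc j) ≡ (j <ᵇ 2 + t)) → (∀ j → 2 + t ≤ j → P j ≡ false) →
    a ≡ 3 + t ⊎ a ≡ 4 + t → invariant (ones (4 + t) S) ≡ (4 + t , (a ≡ᵇ 4 + t))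
  invariant-tail S P a memS step vanish a∈ =
    trans (invariant-by-steps (ones (4 + t) S) Q (4 + t) atQ ≤-refl steps) (cong (4 + t ,_) tag)
    where
    Q : ℕ → Bool
    Q j = P j xor (a ≡ᵇ j)
    a≥ : 2 + t ≤ a
    a≥ = bound a∈
      where
      bound : a ≡ 3 + t ⊎ a ≡ 4 + t → 2 + t ≤ a
      bound (inj₁ a≡) = subst (2 + t ≤_) (sym a≡) (n≤1+n _)
      bound (inj₂ a≡) = subst (2 + t ≤_) (sym a≡) (≤-trans (n≤1+n _) (n≤1+n _))
    atQ : ∀ j → j < 5 + t → at (ones (4 + t) S) j ≡ Q j
    atQ j j< = trans (at-ones (4 + t) S j j<)
      (trans (memS j) (∨-as-xor (P j) (a ≡ᵇ j) (λ e → vanish j (subst (2 + t ≤_) (≡ᵇ-true⇒≡ e) a≥))))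
    steps : ∀ j → j < 4 + t → diff (4 + t) Q j ≡ (j <ᵇ 4 + t)
    steps j j< = begin
      diff (4 + t) Q j
        ≡⟨ diff-xor (4 + t) P (a ≡ᵇ_) j ⟩
      diff (4 + t) P j xor diff (4 + t) (a ≡ᵇ_) j
        ≡⟨ cong₂ _xor_ (trans (diff-vanishing (4 + t) P j (vanish (4 + t) (≤-trans (n≤1+n _) (n≤1+n _)))) (step j))
                       (diff-last-pair a j a∈ j<) ⟩
      (j <ᵇ 2 + t) xor ((j ≡ᵇ 2 + t) xor (j ≡ᵇ 3 + t))
        ≡⟨ sym (xor-assoc (j <ᵇ 2 + t) _ _) ⟩
      ((j <ᵇ 2 + t) xor (j ≡ᵇ 2 + t)) xor (j ≡ᵇ 3 + t)
        ≡⟨ sym (trans (<ᵇ-suc j (3 + t)) (cong (_xor (j ≡ᵇ 3 + t)) (<ᵇ-suc j (2 + t)))) ⟩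
      (j <ᵇ 4 + t) ∎
      where open ≡-Reasoning
    tag : extreme (4 + t) ∧ Q (4 + t) ≡ (a ≡ᵇ 4 + t)
    tag rewrite ≡ᵇ-refl t | vanish (4 + t) (≤-trans (n≤1+n _) (n≤1+n _)) = refl

  invariant-fork : invariant (ones (4 + t) (3 + t ∷ 4 + t ∷ [])) ≡ (0 , true)
  invariant-fork = trans (invariant-by-steps (ones (4 + t) (3 + t ∷ 4 + t ∷ [])) Q 0 atQ z≤n steps) (cong (0 ,_) tag)
    where
    Q : ℕ → Bool
    Q j = (3 + t ≡ᵇ j) xor (4 + t ≡ᵇ j)
    atQ : ∀ j → j < 5 + t → at (ones (4 + t) (3 + t ∷ 4 + t ∷ [])) j ≡ Q j
    atQ j j< = trans (at-ones (4 + t) (3 + t ∷ 4 + t ∷ []) j j<)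
      (trans (cong ((3 + t ≡ᵇ j) ∨_) (∨-identityʳ (4 + t ≡ᵇ j)))
             (∨-as-xor (3 + t ≡ᵇ j) (4 + t ≡ᵇ j)
               (λ e → subst (λ x → (3 + t ≡ᵇ x) ≡ false) (≡ᵇ-true⇒≡ {4 + t} {j} e) (≡ᵇ-+-false 0 (3 + t)))))
    steps : ∀ j → j < 4 + t → diff (4 + t) Q j ≡ false
    steps j j< = trans (diff-xor (4 + t) (3 + t ≡ᵇ_) (4 + t ≡ᵇ_) j)
      (trans (cong₂ _xor_ (diff-last-pair (3 + t) j (inj₁ refl) j<) (diff-last-pair (4 + t) j (inj₂ refl) j<))
             (xor-same ((j ≡ᵇ 2 + t) xor (j ≡ᵇ 3 + t))))
    tag : extreme 0 ∧ Q (4 + t) ≡ true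
    tag rewrite ≡ᵇ-refl t | ≡ᵇ-+-false 0 t = refl

  minimal-ones : ∀ S {v} → invariant (ones (4 + t) S) ≡ v → length S ≡ minWeight v →
    weight (ones (4 + t) S) ≤ minWeight (invariant (ones (4 + t) S))
  minimal-ones S inv len = ≤-trans (weight-ones (4 + t) S) (≤-reflexive (trans len (cong minWeight (sym inv))))

  data Attained : ℕ × Bool → Set where
    untagged  : ∀ w → w ≤ 4 + t → Attained (w , false)
    tagged₀   : Attained (0 , true)
    taggedₙ   : Attained (4 + t , true)

  attained : ∀ d → Attained (invariant d)
  attained d with extreme (jumps d) ∧ at d (4 + t) in tag
  ... | false = untagged (jumps d) (jumps≤ d)
  ... | true with extreme-cases (proj₁ (∧-true⇒ tag))
  ...   | inj₁ j≡0 = subst (λ w → Attained (w , true)) (sym j≡0) tagged₀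
  ...   | inj₂ j≡n = subst (λ w → Attained (w , true)) (sym j≡n) taggedₙ

  classification : ∀ R → Unique (map invariant R) → (∀ d → invariant d ∈ map invariant R) →
    All (λ r → weight r ≤ minWeight (invariant r)) R → length R ≡ (4 + t) + 3 → Classification (4 + t) R
  classification R unique cover minimal len =
    (enumerate , enumerate-injective , enumerate-covers) , len , injective , covers , minimality
    where
    injective : ∀ i j → lookup R i ∼⟨ Yₜ ⟩ lookup R j → i ≡ j
    injective i j i∼j = lookup-injective invariant R unique i j (invariant-∼ i∼j)
    covers : ∀ d → ∃ λ i → d ∼⟨ Yₜ ⟩ lookup R i
    covers d =
      let r , r∈ , d↦r = ∈-map⁻ invariant (cover d)
      in  Any.index r∈ , invariant-complete d (lookup R (Any.index r∈)) (trans d↦r (cong invariant (lookup-index r∈)))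
    minimality : ∀ i d → lookup R i ∼⟨ Yₜ ⟩ d → weight (lookup R i) ≤ weight d
    minimality i d i∼d = begin
      weight (lookup R i)                ≤⟨ All.lookup minimal (∈-lookup i) ⟩
      minWeight (invariant (lookup R i)) ≡⟨ cong minWeight (invariant-∼ i∼d) ⟩
      minWeight (invariant d)            ≤⟨ minWeight≤weight d ⟩
      weight d                           ∎
      where open ≤-Reasoning
    enumerate : Fin ((4 + t) + 3) → Labeling (5 + t)
    enumerate i = lookup R (cast (sym len) i)
    enumerate-injective : ∀ i j → enumerate i ∼⟨ Yₜ ⟩ enumerate j → i ≡ j
    enumerate-injective i j i∼j = begin
      i                              ≡⟨ sym (cast-involutive len (sym len) i) ⟩
      cast len (cast (sym len) i)    ≡⟨ cong (cast len) (injective _ _ i∼j) ⟩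
      cast len (cast (sym len) j)    ≡⟨ cast-involutive len (sym len) j ⟩
      j                              ∎
      where open ≡-Reasoning
    enumerate-covers : ∀ d → ∃ λ i → d ∼⟨ Yₜ ⟩ enumerate i
    enumerate-covers d =
      let i , d∼i = covers d
      in  cast len i , subst (λ k → d ∼⟨ Yₜ ⟩ lookup R k) (sym (cast-involutive (sym len) len i)) d∼i

∈-map-upTo⁻ : ∀ {A : Set} (f : ℕ → A) {k v} → v ∈ map f (upTo k) → ∃ λ i → i < k × v ≡ f i
∈-map-upTo⁻ f v∈ = let i , i∈ , v≡ = ∈-map⁻ f v∈ in i , ∈-upTo⁻ i∈ , v≡

∈-map-upTo⁺ : ∀ {A : Set} (f : ℕ → A) {k i} → i < k → f i ∈ map f (upTo k)
∈-map-upTo⁺ f i<k = ∈-map⁺ f (∈-upTo⁺ i<k)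

map-upTo-cong : ∀ {A : Set} {f g : ℕ → A} k → (∀ i → i < k → f i ≡ g i) → map f (upTo k) ≡ map g (upTo k)
map-upTo-cong k h = map-cong-local (All.tabulate (λ {i} i∈ → h i (∈-upTo⁻ i∈)))

evenInvariants oddInvariants : ℕ → List (ℕ × Bool)
evenInvariants k = map (λ i → twice i , false) (upTo k)
oddInvariants  k = map (λ i → suc (twice i) , false) (upTo k)

unique-evenInvariants : ∀ k → Unique (evenInvariants k)
unique-evenInvariants k = Unique.map⁺ (twice-injective ∘ cong proj₁) (Unique.upTo⁺ k)

unique-oddInvariants : ∀ k → Unique (oddInvariants k)
unique-oddInvariants k = Unique.map⁺ (twice-injective ∘ suc-injective ∘ cong proj₁) (Unique.upTo⁺ k)

module _ {k : ℕ} where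

  tagged∉evenInvariants : ∀ {w} → (w , true) ∉ evenInvariants k
  tagged∉evenInvariants v∈ with ∈-map-upTo⁻ _ v∈
  ... | _ , _ , ()

  tagged∉oddInvariants : ∀ {w} → (w , true) ∉ oddInvariants k
  tagged∉oddInvariants v∈ with ∈-map-upTo⁻ _ v∈
  ... | _ , _ , ()

  odd∉evenInvariants : ∀ {j b} → (suc (twice j) , b) ∉ evenInvariants k
  odd∉evenInvariants v∈ with ∈-map-upTo⁻ _ v∈
  ... | i , _ , e = twice≢suc-twice i _ (sym (cong proj₁ e))

  even∉oddInvariants : ∀ {j b} → (twice j , b) ∉ oddInvariants k
  even∉oddInvariants v∈ with ∈-map-upTo⁻ _ v∈
  ... | i , _ , e = twice≢suc-twice _ i (cong proj₁ e)

  twice-k∉evenInvariants : ∀ {b} → (twice k , b) ∉ evenInvariants k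
  twice-k∉evenInvariants v∈ with ∈-map-upTo⁻ _ v∈
  ... | i , i<k , e = <-irrefl (sym (twice-injective (cong proj₁ e))) i<k

  suc-twice-k∉oddInvariants : ∀ {b} → (suc (twice k) , b) ∉ oddInvariants k
  suc-twice-k∉oddInvariants v∈ with ∈-map-upTo⁻ _ v∈
  ... | i , i<k , e = <-irrefl (sym (twice-injective (suc-injective (cong proj₁ e)))) i<k

evenInvariants-disjoint-odd : ∀ {k k′ v} → v ∈ evenInvariants k → v ∉ oddInvariants k′
evenInvariants-disjoint-odd v∈ with ∈-map-upTo⁻ _ v∈
... | _ , _ , refl = even∉oddInvariants

module Even (u : ℕ) where

  private
    t = twice u
    n = 4 + t
    k = 2 + u

  R : List (Labeling (suc n))
  R = repsEven n k

  V : List (ℕ × Bool)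
  V = evenInvariants k ++ (0 , true) ∷ (n , false) ∷ (n , true) ∷ oddInvariants k

  bound-odds : ∀ {i} → i < k → twice i ≤ 4 + t
  bound-odds i<k = ≤-trans (twice-mono (≤-pred i<k)) (≤-trans (n≤1+n _) (n≤1+n _))

  bound-evens : ∀ {i} → i < k → suc (twice i) ≤ 4 + t
  bound-evens i<k = s≤s (≤-trans (twice-mono (≤-pred i<k)) (n≤1+n _))

  invariant-tails : ∀ a → a ≡ 3 + t ⊎ a ≡ 4 + t → invariant t (ones n (odds (1 + u) ++ a ∷ [])) ≡ (n , (a ≡ᵇ n))
  invariant-tails a a∈ = invariant-tail t (odds (1 + u) ++ a ∷ []) (oddPattern (1 + u)) a
    (λ j → trans (mem-++ (odds (1 + u)) (a ∷ []) j) (cong₂ _∨_ (mem-odds (1 + u) j) (∨-identityʳ (a ≡ᵇ j))))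
    (oddPattern-step (1 + u)) (oddPattern-beyond (1 + u)) a∈

  tails : invariant t (ones n (odds (1 + u) ++ 3 + t ∷ [])) ≡ (n , false)
        × invariant t (ones n (odds (1 + u) ++ 4 + t ∷ [])) ≡ (n , true)
  tails = trans (invariant-tails (3 + t) (inj₁ refl)) (cong (n ,_) (≡ᵇ-+-false 0 (3 + t)))
        , trans (invariant-tails (4 + t) (inj₂ refl)) (cong (n ,_) (≡ᵇ-refl n))

  invariants : map (invariant t) R ≡ V
  invariants = trans (map-++ (invariant t) (map (λ i → ones n (odds i)) (upTo k)) _)
    (cong₂ _++_ (trans (sym (map-∘ (upTo k))) (map-upTo-cong k (λ i i<k → invariant-odds t i (bound-odds i<k))))
      (cong₂ _∷_ (invariant-fork t)
        (cong₂ _∷_ (proj₁ tails)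
          (cong₂ _∷_ (proj₂ tails)
            (trans (sym (map-∘ (upTo k))) (map-upTo-cong k (λ i i<k → invariant-evens t i (bound-evens i<k))))))))

  unique : Unique V
  unique = Unique.++⁺ (unique-evenInvariants k)
    ( ((λ ()) ∷ (λ ()) ∷ All.tabulate (λ v∈ e → tagged∉oddInvariants (subst (_∈ _) (sym e) v∈)))
    ∷ ((λ ()) ∷ All.tabulate (λ v∈ e → even∉oddInvariants {j = k} (subst (_∈ _) (sym e) v∈)))
    ∷ All.tabulate (λ v∈ e → tagged∉oddInvariants (subst (_∈ _) (sym e) v∈))
    ∷ unique-oddInvariants k)
    disjoint
    where
    disjoint : ∀ {v} → ¬ (v ∈ evenInvariants k × v ∈ (0 , true) ∷ (n , false) ∷ (n , true) ∷ oddInvariants k)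
    disjoint (v∈E , here refl)                 = tagged∉evenInvariants v∈E
    disjoint (v∈E , there (here refl))         = twice-k∉evenInvariants v∈E
    disjoint (v∈E , there (there (here refl))) = tagged∉evenInvariants v∈E
    disjoint (v∈E , there (there (there v∈O))) = evenInvariants-disjoint-odd v∈E v∈O

  covers : ∀ d → invariant t d ∈ V
  covers d = from-attained (attained t d)
    where
    rest : ∀ {v} → v ∈ (0 , true) ∷ (n , false) ∷ (n , true) ∷ oddInvariants k → v ∈ V
    rest = ∈-++⁺ʳ (evenInvariants k)
    from-attained : ∀ {v} → Attained t v → v ∈ V
    from-attained tagged₀ = rest (here refl)
    from-attained taggedₙ = rest (there (there (here refl)))
    from-attained (untagged w w≤) with parity w
    ... | odd i = rest (there (there (there (∈-map-upTo⁺ _ (twice-cancel-≤ (suc i) k (s≤s w≤))))))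
    ... | even i with m≤n⇒m<n∨m≡n (twice-cancel-≤ i k (≤-trans w≤ (n≤1+n _)))
    ...   | inj₁ i<k  = ∈-++⁺ˡ (∈-map-upTo⁺ _ i<k)
    ...   | inj₂ refl = rest (there (here refl))

  minimal : All (λ r → weight r ≤ minWeight (invariant t r)) R
  minimal = AllP.++⁺
    (AllP.map⁺ (All.tabulate λ {i} i∈ → minimal-ones t (odds i) (invariant-odds t i (bound-odds (∈-upTo⁻ i∈)))
                 (trans (length-odds i) (sym (trans (minWeight-untagged (twice i)) (⌈twice/2⌉ i))))))
    ( minimal-ones t (3 + t ∷ 4 + t ∷ []) (invariant-fork t) refl
    ∷ minimal-ones t (odds (1 + u) ++ 3 + t ∷ []) (proj₁ tails) tail-length
    ∷ minimal-ones t (odds (1 + u) ++ 4 + t ∷ []) (proj₂ tails) tail-length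
    ∷ AllP.map⁺ (All.tabulate λ {i} i∈ → minimal-ones t (0 ∷ evens i) (invariant-evens t i (bound-evens (∈-upTo⁻ i∈)))
                 (trans (cong suc (length-evens i)) (sym (⌈suc-twice/2⌉ i)))))
    where
    tail-length : ∀ {a} → length (odds (1 + u) ++ a ∷ []) ≡ minWeight (n , false)
    tail-length = trans (length-++ (odds (1 + u))) (trans (cong (_+ 1) (length-odds (1 + u)))
                    (trans (+-comm (1 + u) 1) (sym (trans (minWeight-untagged (twice k)) (⌈twice/2⌉ k)))))

  length-R : length R ≡ n + 3
  length-R = begin
    length R                     ≡⟨ sym (length-map (invariant t) R) ⟩
    length (map (invariant t) R) ≡⟨ cong length invariants ⟩
    length V                     ≡⟨ length-++ (evenInvariants k) ⟩
    length (evenInvariants k) + (3 + length (oddInvariants k))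
      ≡⟨ cong₂ (λ a b → a + (3 + b)) (trans (length-map _ (upTo k)) (length-upTo k))
                                     (trans (length-map _ (upTo k)) (length-upTo k)) ⟩
    k + (3 + k)                  ≡⟨ arithmetic u ⟩
    (4 + (u + u)) + 3            ≡⟨ cong (λ x → (4 + x) + 3) (sym (twice≡+ u)) ⟩
    n + 3                        ∎
    where
    open ≡-Reasoning
    arithmetic : ∀ u → (2 + u) + (3 + (2 + u)) ≡ (4 + (u + u)) + 3
    arithmetic = +-*-Solver.solve 1 (λ u → (con 2 :+ u) :+ (con 3 :+ (con 2 :+ u)) := (con 4 :+ (u :+ u)) :+ con 3) refl
      where open +-*-Solver

  reps≡R : reps n ≡ R
  reps≡R = cong₂ (λ r q → if r ≡ᵇ 0 then repsEven n q else repsOdd n q) (twice-%2 k) (twice-/2 k)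

  classification-reps : Classification n (reps n)
  classification-reps = subst (Classification n) (sym reps≡R)
    (classification t R (subst Unique (sym invariants) unique) (λ d → subst (invariant t d ∈_) (sym invariants) (covers d))
                    minimal length-R)

module Odd (u : ℕ) where

  private
    t = suc (twice u)
    n = 4 + t
    k = 2 + u

  R : List (Labeling (suc n))
  R = repsOdd n k

  V : List (ℕ × Bool)
  V = evenInvariants (suc k) ++ (0 , true) ∷ oddInvariants k ++ (n , false) ∷ (n , true) ∷ []

  bound-odds : ∀ {i} → i < suc k → twice i ≤ 4 + t
  bound-odds i<k = ≤-trans (twice-mono (≤-pred i<k)) (n≤1+n _)

  bound-evens : ∀ {i} → i < k → suc (twice i) ≤ 4 + t
  bound-evens i<k = s≤s (≤-trans (twice-mono (≤-pred i<k)) (≤-trans (n≤1+n _) (n≤1+n _)))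

  invariant-tails : ∀ a → a ≡ 3 + t ⊎ a ≡ 4 + t → invariant t (ones n (0 ∷ evens (1 + u) ++ a ∷ [])) ≡ (n , (a ≡ᵇ n))
  invariant-tails a a∈ = invariant-tail t (0 ∷ evens (1 + u) ++ a ∷ []) (evenPattern (1 + u)) a
    (λ j → trans (cong ((0 ≡ᵇ j) ∨_) (mem-++ (evens (1 + u)) (a ∷ []) j))
             (trans (sym (∨-assoc (0 ≡ᵇ j) _ _)) (cong₂ _∨_ (mem-evens (1 + u) j) (∨-identityʳ (a ≡ᵇ j)))))
    (evenPattern-step (1 + u)) (evenPattern-beyond (1 + u)) a∈

  tails : invariant t (ones n (0 ∷ evens (1 + u) ++ 3 + t ∷ [])) ≡ (n , false)
        × invariant t (ones n (0 ∷ evens (1 + u) ++ 4 + t ∷ [])) ≡ (n , true)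
  tails = trans (invariant-tails (3 + t) (inj₁ refl)) (cong (n ,_) (≡ᵇ-+-false 0 (3 + t)))
        , trans (invariant-tails (4 + t) (inj₂ refl)) (cong (n ,_) (≡ᵇ-refl n))

  invariants : map (invariant t) R ≡ V
  invariants = trans (map-++ (invariant t) (map (λ i → ones n (odds i)) (upTo (suc k))) _)
    (cong₂ _++_ (trans (sym (map-∘ (upTo (suc k)))) (map-upTo-cong (suc k) (λ i i<k → invariant-odds t i (bound-odds i<k))))
      (cong₂ _∷_ (invariant-fork t)
        (trans (map-++ (invariant t) (map (λ i → ones n (0 ∷ evens i)) (upTo k)) _)
          (cong₂ _++_ (trans (sym (map-∘ (upTo k))) (map-upTo-cong k (λ i i<k → invariant-evens t i (bound-evens i<k))))
                      (cong₂ _∷_ (proj₁ tails) (cong₂ _∷_ (proj₂ tails) refl))))))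

  unique : Unique V
  unique = Unique.++⁺ (unique-evenInvariants (suc k))
    ( AllP.++⁺ {xs = oddInvariants k} (All.tabulate (λ v∈ e → tagged∉oddInvariants (subst (_∈ _) (sym e) v∈)))
                                     ((λ ()) ∷ (λ ()) ∷ [])
    ∷ Unique.++⁺ (unique-oddInvariants k) (((λ ()) ∷ []) ∷ [] ∷ []) odd-disjoint)
    disjoint
    where
    odd-disjoint : ∀ {v} → ¬ (v ∈ oddInvariants k × v ∈ (n , false) ∷ (n , true) ∷ [])
    odd-disjoint (v∈O , here refl)         = suc-twice-k∉oddInvariants v∈O
    odd-disjoint (v∈O , there (here refl)) = tagged∉oddInvariants v∈O
    disjoint : ∀ {v} → ¬ (v ∈ evenInvariants (suc k) × v ∈ (0 , true) ∷ oddInvariants k ++ (n , false) ∷ (n , true) ∷ [])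
    disjoint (v∈E , here refl) = tagged∉evenInvariants v∈E
    disjoint (v∈E , there v∈) with ∈-++⁻ (oddInvariants k) v∈
    ... | inj₁ v∈O                = evenInvariants-disjoint-odd v∈E v∈O
    ... | inj₂ (here refl)        = odd∉evenInvariants v∈E
    ... | inj₂ (there (here refl)) = tagged∉evenInvariants v∈E

  covers : ∀ d → invariant t d ∈ V
  covers d = from-attained (attained t d)
    where
    rest : ∀ {v} → v ∈ oddInvariants k ++ (n , false) ∷ (n , true) ∷ [] → v ∈ V
    rest v∈ = ∈-++⁺ʳ (evenInvariants (suc k)) (there v∈)
    from-attained : ∀ {v} → Attained t v → v ∈ V
    from-attained tagged₀ = ∈-++⁺ʳ (evenInvariants (suc k)) (here refl)
    from-attained taggedₙ = rest (∈-++⁺ʳ (oddInvariants k) (there (here refl)))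
    from-attained (untagged w w≤) with parity w
    ... | even i = ∈-++⁺ˡ (∈-map-upTo⁺ _ (s≤s (twice-cancel-≤ i k w≤)))
    ... | odd i with m≤n⇒m<n∨m≡n (twice-cancel-≤ i k (≤-trans (≤-pred w≤) (n≤1+n _)))
    ...   | inj₁ i<k  = rest (∈-++⁺ˡ (∈-map-upTo⁺ _ i<k))
    ...   | inj₂ refl = rest (∈-++⁺ʳ (oddInvariants k) (here refl))

  minimal : All (λ r → weight r ≤ minWeight (invariant t r)) R
  minimal = AllP.++⁺
    (AllP.map⁺ (All.tabulate λ {i} i∈ → minimal-ones t (odds i) (invariant-odds t i (bound-odds (∈-upTo⁻ i∈)))
                 (trans (length-odds i) (sym (trans (minWeight-untagged (twice i)) (⌈twice/2⌉ i))))))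
    ( minimal-ones t (3 + t ∷ 4 + t ∷ []) (invariant-fork t) refl
    ∷ AllP.++⁺
        (AllP.map⁺ (All.tabulate λ {i} i∈ → minimal-ones t (0 ∷ evens i) (invariant-evens t i (bound-evens (∈-upTo⁻ i∈)))
                     (trans (cong suc (length-evens i)) (sym (⌈suc-twice/2⌉ i)))))
        ( minimal-ones t (0 ∷ evens (1 + u) ++ 3 + t ∷ []) (proj₁ tails) tail-length
        ∷ minimal-ones t (0 ∷ evens (1 + u) ++ 4 + t ∷ []) (proj₂ tails) tail-length
        ∷ []))
    where
    tail-length : ∀ {a} → length (0 ∷ evens (1 + u) ++ a ∷ []) ≡ minWeight (n , false)
    tail-length = cong suc (trans (length-++ (evens (1 + u))) (trans (cong (_+ 1) (length-evens (1 + u)))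
                    (trans (+-comm (1 + u) 1) (sym (⌈suc-twice/2⌉ (1 + u))))))

  length-R : length R ≡ n + 3
  length-R = begin
    length R                     ≡⟨ sym (length-map (invariant t) R) ⟩
    length (map (invariant t) R) ≡⟨ cong length invariants ⟩
    length V                     ≡⟨ length-++ (evenInvariants (suc k)) ⟩
    length (evenInvariants (suc k)) + suc (length (oddInvariants k ++ (n , false) ∷ (n , true) ∷ []))
      ≡⟨ cong₂ (λ a b → a + suc b) (trans (length-map _ (upTo (suc k))) (length-upTo (suc k)))
               (trans (length-++ (oddInvariants k)) (cong (_+ 2) (trans (length-map _ (upTo k)) (length-upTo k)))) ⟩
    suc k + suc (k + 2)          ≡⟨ arithmetic u ⟩
    (5 + (u + u)) + 3            ≡⟨ cong (λ x → (5 + x) + 3) (sym (twice≡+ u)) ⟩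
    n + 3                        ∎
    where
    open ≡-Reasoning
    arithmetic : ∀ u → (3 + u) + suc ((2 + u) + 2) ≡ (5 + (u + u)) + 3
    arithmetic = +-*-Solver.solve 1 (λ u → (con 3 :+ u) :+ (con 1 :+ ((con 2 :+ u) :+ con 2)) := (con 5 :+ (u :+ u)) :+ con 3) refl
      where open +-*-Solver

  reps≡R : reps n ≡ R
  reps≡R = cong₂ (λ r q → if r ≡ᵇ 0 then repsEven n q else repsOdd n q) (suc-twice-%2 k) (suc-twice-/2 k)

  classification-reps : Classification n (reps n)
  classification-reps = subst (Classification n) (sym reps≡R)
    (classification t R (subst Unique (sym invariants) unique) (λ d → subst (invariant t d ∈_) (sym invariants) (covers d))
                    minimal length-R)

proposition2p55 : (n : ℕ) → 4 ≤ n →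
    -- #Cl(Y_n) = n + 3
    (Σ (Fin (n + 3) → Labeling (suc n)) λ f →
        (∀ i j → f i ∼⟨ Y n ⟩ f j → i ≡ j)
      × (∀ d → ∃ λ i → d ∼⟨ Y n ⟩ f i))
    -- the listed labelings form a system of minimal representatives
    × (length (reps n) ≡ n + 3
      × (∀ i j → lookup (reps n) i ∼⟨ Y n ⟩ lookup (reps n) j → i ≡ j)
      × (∀ d → ∃ λ i → d ∼⟨ Y n ⟩ lookup (reps n) i)
      × (∀ i d → lookup (reps n) i ∼⟨ Y n ⟩ d → weight (lookup (reps n) i) ≤ weight d))
proposition2p55 (suc (suc (suc (suc t)))) (s≤s (s≤s (s≤s (s≤s z≤n)))) with parity t
... | even u = Even.classification-reps u
... | odd  u = Odd.classification-reps u
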